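{- Let $\mathcal{C}$ be a permutation class. The following are equivalent. (1) There exists a $\mathsf{TOTO}$ sentence $\psi$ such that for every $\sigma\in\mathcal{C}$, $\sigma\models\psi$ if and only if $\sigma$ has a fixed point. (2) There exists a $\mathsf{TOTO}$ formula $\phi(x)$ with one free variable such that for every $\sigma\in\mathcal{C}$ and every element $a$ of $\sigma$, $(\sigma,a)\models\phi(x)$ if and only if $a$ is a fixed point of $\sigma$. (3) There exist positive integers $k,m,n$ such that neither $\delta_k$ nor $321[\iota_m,1,\iota_n]$ belongs to $\mathcal{C}$.
   Context: A permutation $\sigma$ of size $N$ is identified with the finite structure whose domain is $A^\sigma=\{(i,\sigma(i)) : 1\le i\le N\}$, with position order $<_P$ (comparing first coordinates) and value order $<_V$ (comparing second coordinates); $\mathsf{TOTO}$ is first-order logic (with equality) over the signature $\{<_P,<_V\}$. An element $(i,\sigma(i))$ is a fixed point if $\sigma(i)=i$. A permutation $\sigma$ contains $\pi$ (as a pattern) if some subsequence of the one-line notation of $\sigma$ is order-isomorphic to $\pi$; a permutation class is a set of permutations closed under taking patterns. $\iota_n=12\cdots n$, $\delta_k=k\cdots21$. For $\pi$ of size $r$ and permutations $\sigma_1,\dots,\sigma_r$, the inflation $\pi[\sigma_1,\dots,\sigma_r]$ is obtained from the diagram of $\pi$ by replacing each point $(i,\pi(i))$ with the diagram of $\sigma_i$; thus $321[\iota_m,1,\iota_n]$ consists of an increasing sequence of length $m$, then a single point, then an increasing sequence of length $n$, each block lying entirely below the preceding ones. -}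

module Defs where

open import Data.Nat as ℕ using (ℕ; zero; suc)
open import Data.Nat.Properties using (+-comm)
open import Data.Fin using (Fin; zero; suc; toℕ; opposite; fromℕ; inject₁; splitAt; join; cast; _<_)
open import Data.Fin.Properties
  using (toℕ-injective; toℕ-cast; splitAt-join; join-splitAt; opposite-involutive; fromℕ≢inject₁; inject₁-injective)
open import Data.Sum using (_⊎_; inj₁; inj₂)
open import Data.Product using (Σ; _×_; _,_)
open import Data.Empty using (⊥; ⊥-elim)
open import Relation.Nullary using (¬_)
open import Relation.Binary.PropositionalEquality using (_≡_; refl; cong; sym; trans)
open import Function.Definitions using (Injective)
open import Function.Bundles using (_⇔_)

-- Position i (0-based) carries value fun i; the element (i, σ(i)) of the
-- structure A^σ is identified with its position i : Fin N.

record Perm (N : ℕ) : Set where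
  constructor mkPerm
  field
    fun : Fin N → Fin N
    inj : Injective _≡_ _≡_ fun
open Perm public

IsFixedPoint : ∀ {N} → Perm N → Fin N → Set
IsFixedPoint σ a = fun σ a ≡ a

HasFixedPoint : ∀ {N} → Perm N → Set
HasFixedPoint σ = Σ (Fin _) λ a → IsFixedPoint σ a

_≼_ : ∀ {r N} → Perm r → Perm N → Set
_≼_ {r} {N} π σ =
  Σ (Fin r → Fin N) λ e →
    (∀ i j → i < j → e i < e j) ×
    (∀ i j → (fun π i < fun π j) ⇔ (fun σ (e i) < fun σ (e j)))

IsPermClass : (∀ {N} → Perm N → Set) → Set
IsPermClass C = ∀ {r N} (π : Perm r) (σ : Perm N) → C σ → π ≼ σ → C π

δ : (k : ℕ) → Perm k
δ k = mkPerm opposite inj-opp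
  where
  inj-opp : Injective _≡_ _≡_ (opposite {k})
  inj-opp {x} {y} e =
    trans (sym (opposite-involutive x)) (trans (cong opposite e) (opposite-involutive y))

-- 321[ι_m, 1, ι_n], of size m + (1 + n):
--   positions 0..m-1      ↦ values n+1 .. n+m   (increasing, top block)
--   position  m           ↦ value  n            (the single point)
--   positions m+1..m+n    ↦ values 0 .. n-1     (increasing, bottom block)

private
  rot : ∀ n → Fin (suc n) → Fin (suc n)
  rot n zero    = fromℕ n
  rot n (suc j) = inject₁ j

  rot-inj : ∀ n → Injective _≡_ _≡_ (rot n)
  rot-inj n {zero}  {zero}  e = refl
  rot-inj n {zero}  {suc y} e = ⊥-elim (fromℕ≢inject₁ e)
  rot-inj n {suc x} {zero}  e = ⊥-elim (fromℕ≢inject₁ (sym e))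
  rot-inj n {suc x} {suc y} e = cong suc (inject₁-injective e)

  g : ∀ m n → Fin m ⊎ Fin (suc n) → Fin (suc n) ⊎ Fin m
  g m n (inj₁ i) = inj₂ i
  g m n (inj₂ y) = inj₁ (rot n y)

  g-inj : ∀ m n → Injective _≡_ _≡_ (g m n)
  g-inj m n {inj₁ x} {inj₁ y} refl = refl
  g-inj m n {inj₂ x} {inj₂ y} e = cong inj₂ (rot-inj n (h e))
    where
    h : ∀ {a b : Fin (suc n)} → inj₁ {B = Fin m} a ≡ inj₁ b → a ≡ b
    h refl = refl
  g-inj m n {inj₁ x} {inj₂ y} ()
  g-inj m n {inj₂ x} {inj₁ y} ()

p321-fun : ∀ m n → Fin (m ℕ.+ suc n) → Fin (m ℕ.+ suc n)
p321-fun m n i = cast (+-comm (suc n) m) (join (suc n) m (g m n (splitAt m i)))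

p321 : (m n : ℕ) → Perm (m ℕ.+ suc n)
p321 m n = mkPerm (p321-fun m n) p-inj
  where
  p-inj : Injective _≡_ _≡_ (p321-fun m n)
  p-inj {x} {y} e =
    trans (sym (join-splitAt m (suc n) x))
      (trans (cong (join m (suc n)) s≡) (join-splitAt m (suc n) y))
    where
    j≡ : join (suc n) m (g m n (splitAt m x)) ≡ join (suc n) m (g m n (splitAt m y))
    j≡ = toℕ-injective
           (trans (sym (toℕ-cast (+-comm (suc n) m) _))
             (trans (cong toℕ e) (toℕ-cast (+-comm (suc n) m) _)))
    s≡ : splitAt m x ≡ splitAt m y
    s≡ = g-inj m n (trans (sym (splitAt-join (suc n) m _))
                     (trans (cong (splitAt (suc n)) j≡) (splitAt-join (suc n) m _)))

-- TOTO: first-order logic with equality over the signature {<_P, <_V}.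
-- Formula n = formulas whose free variables are among n de Bruijn indices.

data Formula (n : ℕ) : Set where
  _≐_ _<P_ _<V_ : Fin n → Fin n → Formula n
  ⊤′ ⊥′          : Formula n
  ¬′_            : Formula n → Formula n
  _∧′_ _∨′_ _⇒′_ : Formula n → Formula n → Formula n
  ∀′ ∃′          : Formula (suc n) → Formula n

Sentence : Set
Sentence = Formula 0

_∷ₐ_ : ∀ {n N} → Fin N → (Fin n → Fin N) → Fin (suc n) → Fin N
(a ∷ₐ ρ) zero    = a
(a ∷ₐ ρ) (suc i) = ρ i

_⊨_[_] : ∀ {N n} → Perm N → Formula n → (Fin n → Fin N) → Set
σ ⊨ (x ≐ y)  [ ρ ] = ρ x ≡ ρ y
σ ⊨ (x <P y) [ ρ ] = ρ x < ρ y
σ ⊨ (x <V y) [ ρ ] = fun σ (ρ x) < fun σ (ρ y)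
σ ⊨ ⊤′       [ ρ ] = ¬ ⊥
σ ⊨ ⊥′       [ ρ ] = ⊥
σ ⊨ (¬′ φ)   [ ρ ] = ¬ (σ ⊨ φ [ ρ ])
σ ⊨ (φ ∧′ ψ) [ ρ ] = (σ ⊨ φ [ ρ ]) × (σ ⊨ ψ [ ρ ])
σ ⊨ (φ ∨′ ψ) [ ρ ] = (σ ⊨ φ [ ρ ]) ⊎ (σ ⊨ ψ [ ρ ])
σ ⊨ (φ ⇒′ ψ) [ ρ ] = (σ ⊨ φ [ ρ ]) → (σ ⊨ ψ [ ρ ])
σ ⊨ (∀′ φ)   [ ρ ] = (a : Fin _) → σ ⊨ φ [ a ∷ₐ ρ ]
σ ⊨ (∃′ φ)   [ ρ ] = Σ (Fin _) λ a → σ ⊨ φ [ a ∷ₐ ρ ]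

_⊨ₛ_ : ∀ {N} → Perm N → Sentence → Set
σ ⊨ₛ ψ = σ ⊨ ψ [ (λ ()) ]

_,_⊨₁_ : ∀ {N} → Perm N → Fin N → Formula 1 → Set
σ , a ⊨₁ φ = σ ⊨ φ [ (λ _ → a) ]

-- A point a of σ is a fixed point iff the number of points north-west of it equals the number
-- south-east of it, because a counts the points to its left and σ(a) the points below it, and
-- both counts contain the south-west points. If δ k and 321[ι m, 1, ι n] are avoided, an
-- Erdős–Szekeres argument bounds one of the two quadrant counts, so "both counts equal some
-- c ≤ B" is first order; this gives (3) ⇒ (2), and (2) ⇒ (1) by existential quantification.
-- Conversely, with T = 2 ^ q no sentence of quantifier rank q separates δ (2T) from δ (2T + 1),
-- or 321[ι T, 1, ι T] from 321[ι T, 1, ι (T + 1)]: Duplicator keeps all distances between chosen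
-- points and marked points equal up to 2 ^ (rounds left). In each pair exactly one member has a
-- fixed point and the first is a pattern of the second, so a class on which a sentence defines
-- fixed points avoids the second members.

module Submission where

open import Defs
open import Data.Nat using (ℕ; _<_)
open import Data.Product using (Σ; _×_)
open import Function.Bundles using (_⇔_)
open import Relation.Nullary using (¬_)

open import Data.Nat using (zero; suc; _+_; _∸_; _^_; _⊓_; _⊔_; _≤_; z≤n; s≤s; z<s; s<s; s<s⁻¹; s≤s⁻¹; _≤?_; _<?_; _≟_)
open import Data.Nat.Properties
open import Data.Fin as F using (Fin; zero; suc; toℕ; _↑ˡ_; _↑ʳ_; splitAt; opposite; punchIn; punchOut)
import Data.Fin.Properties as FP
open import Data.Product using (_,_; proj₁; proj₂)
open import Data.Product.Function.NonDependent.Propositional using (_×-⇔_)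
open import Data.Sum as Sum using (_⊎_; inj₁; inj₂; [_,_]′)
open import Data.Sum.Properties using ([,]-map)
open import Data.Sum.Function.Propositional using (_⊎-⇔_)
open import Data.Vec.Functional using ([]; _∷_; _++_)
open import Data.Vec.Functional.Properties using (lookup-++ˡ; lookup-++ʳ)
open import Data.Empty using (⊥-elim)
open import Data.Unit using (⊤; tt)
open import Relation.Nullary using (Dec; yes; no)
open import Relation.Nullary.Decidable using (_×-dec_; _⊎-dec_)
open import Relation.Binary.Definitions using (tri<; tri≈; tri>)
open import Relation.Binary.PropositionalEquality
  using (_≡_; _≢_; _≗_; refl; sym; trans; cong; cong₂; subst; subst₂; module ≡-Reasoning)
open import Function using (_∘_; flip; case_of_)
open import Function.Definitions using (Injective)
open import Function.Bundles using (Equivalence; mk⇔)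
open import Function.Construct.Composition using (_⇔-∘_)
open import Function.Construct.Identity using (⇔-id)
open import Function.Construct.Symmetry using (⇔-sym)
open import Function.Related.TypeIsomorphisms using (→-cong-⇔; ¬-cong-⇔)
open import Algebra.Properties.CommutativeMonoid.Sum +-0-commutativeMonoid
  using (sum; sum-cong-≗; sum-replicate-zero; ∑-distrib-+; sum-remove)
open Equivalence using (to; from)

infixr 5 _⟨⇔⟩_
_⟨⇔⟩_ : ∀ {A B C : Set} → A ⇔ B → B ⇔ C → A ⇔ C
p ⟨⇔⟩ q = q ⇔-∘ p

-- Ehrenfeucht–Fraïssé games

rank : ∀ {n} → Formula n → ℕ
rank (x ≐ y)  = 0
rank (x <P y) = 0
rank (x <V y) = 0
rank ⊤′       = 0
rank ⊥′       = 0
rank (¬′ φ)   = rank φ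
rank (φ ∧′ ψ) = rank φ ⊔ rank ψ
rank (φ ∨′ ψ) = rank φ ⊔ rank ψ
rank (φ ⇒′ ψ) = rank φ ⊔ rank ψ
rank (∀′ φ)   = suc (rank φ)
rank (∃′ φ)   = suc (rank φ)

Assignment : ℕ → ℕ → Set
Assignment n N = Fin n → Fin N

record BackAndForth {N N'} (σ : Perm N) (τ : Perm N')
       (R : ℕ → ∀ {n} → Assignment n N → Assignment n N' → Set) : Set where
  field
    ≐-agree  : ∀ {q n ρ ρ'} → R q {n} ρ ρ' → ∀ x y → (ρ x ≡ ρ y) ⇔ (ρ' x ≡ ρ' y)
    <P-agree : ∀ {q n ρ ρ'} → R q {n} ρ ρ' → ∀ x y → (ρ x F.< ρ y) ⇔ (ρ' x F.< ρ' y)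
    <V-agree : ∀ {q n ρ ρ'} → R q {n} ρ ρ' → ∀ x y →
               (fun σ (ρ x) F.< fun σ (ρ y)) ⇔ (fun τ (ρ' x) F.< fun τ (ρ' y))
    forth    : ∀ {q n ρ ρ'} → R (suc q) {n} ρ ρ' → ∀ a → Σ (Fin N') λ a' → R q (a ∷ₐ ρ) (a' ∷ₐ ρ')
    back     : ∀ {q n ρ ρ'} → R (suc q) {n} ρ ρ' → ∀ a' → Σ (Fin N) λ a → R q (a ∷ₐ ρ) (a' ∷ₐ ρ')

module _ {N N'} {σ : Perm N} {τ : Perm N'} {R} (G : BackAndForth σ τ R) where
  open BackAndForth G

  transfer : ∀ q {n} (φ : Formula n) → rank φ ≤ q → ∀ {ρ ρ'} → R q ρ ρ' →
             (σ ⊨ φ [ ρ ]) ⇔ (τ ⊨ φ [ ρ' ])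
  transfer q (x ≐ y)  _ r = ≐-agree r x y
  transfer q (x <P y) _ r = <P-agree r x y
  transfer q (x <V y) _ r = <V-agree r x y
  transfer q ⊤′       _ r = ⇔-id _
  transfer q ⊥′       _ r = ⇔-id _
  transfer q (¬′ φ)   rk r = ¬-cong-⇔ (transfer q φ rk r)
  transfer q (φ ∧′ ψ) rk r =
    transfer q φ (m⊔n≤o⇒m≤o _ _ rk) r ×-⇔ transfer q ψ (m⊔n≤o⇒n≤o (rank φ) _ rk) r
  transfer q (φ ∨′ ψ) rk r =
    transfer q φ (m⊔n≤o⇒m≤o _ _ rk) r ⊎-⇔ transfer q ψ (m⊔n≤o⇒n≤o (rank φ) _ rk) r
  transfer q (φ ⇒′ ψ) rk r =
    →-cong-⇔ (transfer q φ (m⊔n≤o⇒m≤o _ _ rk) r) (transfer q ψ (m⊔n≤o⇒n≤o (rank φ) _ rk) r)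
  transfer (suc q) (∀′ φ) (s≤s rk) r = mk⇔
    (λ h a' → let (a , r') = back r a' in to (transfer q φ rk r') (h a))
    (λ h a → let (a' , r') = forth r a in from (transfer q φ rk r') (h a'))
  transfer (suc q) (∃′ φ) (s≤s rk) r = mk⇔
    (λ (a , h) → let (a' , r') = forth r a in a' , to (transfer q φ rk r') h)
    (λ (a' , h) → let (a , r') = back r a' in a , from (transfer q φ rk r') h)

≗-backAndForth : ∀ {N} (σ : Perm N) → BackAndForth σ σ (λ _ ρ ρ' → ρ ≗ ρ')
≗-backAndForth σ = record
  { ≐-agree  = λ p x y → mk⇔ (λ e → trans (sym (p x)) (trans e (p y)))
                             (λ e → trans (p x) (trans e (sym (p y))))
  ; <P-agree = λ p x y → mk⇔ (subst₂ F._<_ (p x) (p y)) (subst₂ F._<_ (sym (p x)) (sym (p y)))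
  ; <V-agree = λ p x y → mk⇔ (subst₂ (λ u v → fun σ u F.< fun σ v) (p x) (p y))
                             (subst₂ (λ u v → fun σ u F.< fun σ v) (sym (p x)) (sym (p y)))
  ; forth    = λ p a → a , extend p
  ; back     = λ p a → a , extend p
  }
  where
  extend : ∀ {n N} {ρ ρ' : Assignment n N} {a} → ρ ≗ ρ' → (a ∷ₐ ρ) ≗ (a ∷ₐ ρ')
  extend p zero    = refl
  extend p (suc i) = p i

⊨-cong-≗ : ∀ {N n} (σ : Perm N) (φ : Formula n) {ρ ρ' : Assignment n N} → ρ ≗ ρ' →
           (σ ⊨ φ [ ρ ]) ⇔ (σ ⊨ φ [ ρ' ])
⊨-cong-≗ σ φ = transfer (≗-backAndForth σ) (rank φ) φ ≤-refl

-- Positions up to truncated distance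

⊓-≡-≥ : ∀ {T u v} → T ≤ u → T ≤ v → u ⊓ T ≡ v ⊓ T
⊓-≡-≥ T≤u T≤v = trans (m≥n⇒m⊓n≡n T≤u) (sym (m≥n⇒m⊓n≡n T≤v))

⊓-cancel-< : ∀ {u v S} → u ⊓ S ≡ v ⊓ S → u < S → v ≡ u
⊓-cancel-< {u} {v} {S} e u<S with v <? S
... | yes v<S = trans (sym (m≤n⇒m⊓n≡m (<⇒≤ v<S))) (trans (sym e) (m≤n⇒m⊓n≡m (<⇒≤ u<S)))
... | no v≮S  = ⊥-elim (<-irrefl (trans (sym (m≤n⇒m⊓n≡m (<⇒≤ u<S))) (trans e (m≥n⇒m⊓n≡n (≮⇒≥ v≮S)))) u<S)

⊓-cancel-≥ : ∀ {u v S} → u ⊓ S ≡ v ⊓ S → S ≤ u → S ≤ v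
⊓-cancel-≥ {u} {v} {S} e S≤u with v <? S
... | yes v<S = subst (S ≤_) (⊓-cancel-< (sym e) v<S) S≤u
... | no v≮S  = ≮⇒≥ v≮S

⊓-≡-weaken : ∀ {T T' u v} → T ≤ T' → u ⊓ T' ≡ v ⊓ T' → u ⊓ T ≡ v ⊓ T
⊓-≡-weaken {T} {T'} {u} {v} T≤T' e = begin
  u ⊓ T         ≡⟨ cong (u ⊓_) (sym T'⊓T≡T) ⟩
  u ⊓ (T' ⊓ T)  ≡⟨ sym (⊓-assoc u T' T) ⟩
  u ⊓ T' ⊓ T    ≡⟨ cong (_⊓ T) e ⟩
  v ⊓ T' ⊓ T    ≡⟨ ⊓-assoc v T' T ⟩
  v ⊓ (T' ⊓ T)  ≡⟨ cong (v ⊓_) T'⊓T≡T ⟩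
  v ⊓ T         ∎
  where
  open ≡-Reasoning
  T'⊓T≡T : T' ⊓ T ≡ T
  T'⊓T≡T = m≥n⇒m⊓n≡n T≤T'

+-⊓-absorb : ∀ T p q → (p + q) ⊓ T ≡ (p ⊓ T + q ⊓ T) ⊓ T
+-⊓-absorb T p q with p <? T | q <? T
... | yes p<T | yes q<T rewrite m≤n⇒m⊓n≡m (<⇒≤ p<T) | m≤n⇒m⊓n≡m (<⇒≤ q<T) = refl
... | no p≮T | _ rewrite m≥n⇒m⊓n≡n {p} {T} (≮⇒≥ p≮T) =
  ⊓-≡-≥ (≤-trans (≮⇒≥ p≮T) (m≤m+n p q)) (m≤m+n T (q ⊓ T))
... | yes p<T | no q≮T rewrite m≥n⇒m⊓n≡n {q} {T} (≮⇒≥ q≮T) =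
  ⊓-≡-≥ (≤-trans (≮⇒≥ q≮T) (m≤n+m q p)) (m≤n+m T (p ⊓ T))

+-cong-⊓ : ∀ T {p q p' q'} → p ⊓ T ≡ p' ⊓ T → q ⊓ T ≡ q' ⊓ T → (p + q) ⊓ T ≡ (p' + q') ⊓ T
+-cong-⊓ T {p} {q} {p'} {q'} e₁ e₂ =
  trans (+-⊓-absorb T p q) (trans (cong (_⊓ T) (cong₂ _+_ e₁ e₂)) (sym (+-⊓-absorb T p' q')))

⊓-≡-zero : ∀ {T u v} → 1 ≤ T → u ⊓ T ≡ v ⊓ T → u ≡ 0 → v ≡ 0
⊓-≡-zero {suc T} {v = zero}  _ _  refl = refl
⊓-≡-zero {suc T} {v = suc v} _ () refl

∸-split : ∀ {p q r} → p ≤ q → q ≤ r → (q ∸ p) + (r ∸ q) ≡ r ∸ p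
∸-split {p} {q} {r} p≤q q≤r =
  trans (+-comm (q ∸ p) (r ∸ q)) (trans (sym (+-∸-assoc (r ∸ q) p≤q)) (cong (_∸ p) (m∸n+n≡m q≤r)))

split-large-gap : ∀ T x y D → T + T ≤ D → T + T ≤ x + y →
                  Σ ℕ λ x' → x' ≤ D × x' ⊓ T ≡ x ⊓ T × (D ∸ x') ⊓ T ≡ y ⊓ T
split-large-gap T x y D D≥ s≥ with x <? T | y <? T
... | yes x<T | yes y<T = ⊥-elim (<⇒≱ (+-mono-< x<T y<T) s≥)
... | yes x<T | no y≮T =
  x , ≤-trans (<⇒≤ (<-≤-trans x<T (m≤m+n T T))) D≥ , refl ,
  ⊓-≡-≥ (m+n≤o⇒m≤o∸n T (≤-trans (+-monoʳ-≤ T (<⇒≤ x<T)) D≥)) (≮⇒≥ y≮T)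
... | no x≮T | yes y<T =
  D ∸ y , m∸n≤m D y , ⊓-≡-≥ (m+n≤o⇒m≤o∸n T (≤-trans (+-monoʳ-≤ T (<⇒≤ y<T)) D≥)) (≮⇒≥ x≮T) ,
  cong (_⊓ T) (m∸[m∸n]≡n (≤-trans (<⇒≤ (<-≤-trans y<T (m≤m+n T T))) D≥))
... | no x≮T | no y≮T =
  T , ≤-trans (m≤m+n T T) D≥ , ⊓-≡-≥ ≤-refl (≮⇒≥ x≮T) , ⊓-≡-≥ (m+n≤o⇒m≤o∸n T D≥) (≮⇒≥ y≮T)

split-gap : ∀ T x y D → (x + y) ⊓ (T + T) ≡ D ⊓ (T + T) →
            Σ ℕ λ x' → x' ≤ D × x' ⊓ T ≡ x ⊓ T × (D ∸ x') ⊓ T ≡ y ⊓ T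
split-gap T x y D e with x + y <? T + T
... | no s≮2T = split-large-gap T x y D (⊓-cancel-≥ e (≮⇒≥ s≮2T)) (≮⇒≥ s≮2T)
... | yes s<2T with ⊓-cancel-< e s<2T
...   | refl = x , m≤m+n x y , refl , cong (_⊓ T) (m+n∸m≡n x y)

record DistEq {k} (T : ℕ) (E E' : Fin k → ℕ) : Set where
  constructor mkDistEq
  field dist-eq : ∀ i j → (E j ∸ E i) ⊓ T ≡ (E' j ∸ E' i) ⊓ T
open DistEq public

DistEq-sym : ∀ {k T} {E E' : Fin k → ℕ} → DistEq T E E' → DistEq T E' E
DistEq-sym D = mkDistEq λ i j → sym (dist-eq D i j)

DistEq-cong : ∀ {k T} {E E' G G' : Fin k → ℕ} → E ≗ G → E' ≗ G' → DistEq T E E' → DistEq T G G'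
DistEq-cong {T = T} {E} {E'} {G} {G'} p p' D = mkDistEq h
  where
  h : ∀ i j → (G j ∸ G i) ⊓ T ≡ (G' j ∸ G' i) ⊓ T
  h i j rewrite sym (p i) | sym (p j) | sym (p' i) | sym (p' j) = dist-eq D i j

DistEq-≤ : ∀ {k T} {E E' : Fin k → ℕ} → 1 ≤ T → DistEq T E E' → ∀ i j → E i ≤ E j → E' i ≤ E' j
DistEq-≤ T≥1 D i j le = m∸n≡0⇒m≤n (⊓-≡-zero T≥1 (dist-eq D j i) (m≤n⇒m∸n≡0 le))

DistEq-<⇔ : ∀ {k T} {E E' : Fin k → ℕ} → 1 ≤ T → DistEq T E E' → ∀ i j → (E i < E j) ⇔ (E' i < E' j)
DistEq-<⇔ T≥1 D i j = mk⇔
  (λ lt → ≰⇒> λ le → <⇒≱ lt (DistEq-≤ T≥1 (DistEq-sym D) j i le))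
  (λ lt → ≰⇒> λ le → <⇒≱ lt (DistEq-≤ T≥1 D j i le))

DistEq-≡⇔ : ∀ {k T} {E E' : Fin k → ℕ} → 1 ≤ T → DistEq T E E' → ∀ i j → (E i ≡ E j) ⇔ (E' i ≡ E' j)
DistEq-≡⇔ T≥1 D i j = mk⇔
  (λ e → ≤-antisym (DistEq-≤ T≥1 D i j (≤-reflexive e)) (DistEq-≤ T≥1 D j i (≤-reflexive (sym e))))
  (λ e → ≤-antisym (DistEq-≤ T≥1 (DistEq-sym D) i j (≤-reflexive e))
                   (DistEq-≤ T≥1 (DistEq-sym D) j i (≤-reflexive (sym e))))

module _ {_⊑_ : ℕ → ℕ → Set} (⊑-refl : ∀ {x} → x ⊑ x)
         (⊑-trans : ∀ {x y z} → x ⊑ y → y ⊑ z → x ⊑ z) (⊑-total : ∀ x y → x ⊑ y ⊎ y ⊑ x) where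

  extremum? : ∀ {k} (F : Fin k → ℕ) {P : Fin k → Set} → (∀ i → Dec (P i)) →
              (Σ (Fin k) λ l → P l × (∀ i → P i → F l ⊑ F i)) ⊎ (∀ i → ¬ P i)
  extremum? {zero} F P? = inj₂ λ ()
  extremum? {suc k} F P? with extremum? (F ∘ suc) (P? ∘ suc) | P? zero
  ... | inj₂ none | yes p₀ = inj₁ (zero , p₀ , λ { zero _ → ⊑-refl ; (suc i) p → ⊥-elim (none i p) })
  ... | inj₂ none | no ¬p₀ = inj₂ λ { zero → ¬p₀ ; (suc i) → none i }
  ... | inj₁ (l , pl , best) | no ¬p₀ =
    inj₁ (suc l , pl , λ { zero p → ⊥-elim (¬p₀ p) ; (suc i) p → best i p })
  ... | inj₁ (l , pl , best) | yes p₀ with ⊑-total (F (suc l)) (F zero)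
  ...   | inj₁ le = inj₁ (suc l , pl , λ { zero _ → le ; (suc i) p → best i p })
  ...   | inj₂ ge = inj₁ (zero , p₀ , λ { zero _ → ⊑-refl ; (suc i) p → ⊑-trans ge (best i p) })

  extremum : ∀ {k} (F : Fin k → ℕ) {P : Fin k → Set} → (∀ i → Dec (P i)) → ∀ {i₀} → P i₀ →
             Σ (Fin k) λ l → P l × (∀ i → P i → F l ⊑ F i)
  extremum F P? {i₀} p₀ with extremum? F P?
  ... | inj₁ found = found
  ... | inj₂ none  = ⊥-elim (none i₀ p₀)

argmin : ∀ {k} (F : Fin k → ℕ) {P : Fin k → Set} → (∀ i → Dec (P i)) → ∀ {i₀} → P i₀ →
         Σ (Fin k) λ l → P l × (∀ i → P i → F l ≤ F i)
argmin = extremum ≤-refl ≤-trans ≤-total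

argmax : ∀ {k} (F : Fin k → ℕ) {P : Fin k → Set} → (∀ i → Dec (P i)) → ∀ {i₀} → P i₀ →
         Σ (Fin k) λ l → P l × (∀ i → P i → F i ≤ F l)
argmax = extremum ≤-refl (λ p q → ≤-trans q p) (λ x y → ≤-total y x)

module _ {k} (T : ℕ) (T≥1 : 1 ≤ T) {F F' : Fin k → ℕ} (D : DistEq (T + T) F F')
         {a : ℕ} {l r : Fin k} (Fl≤a : F l ≤ a) (a≤Fr : a ≤ F r)
         (l-max : ∀ i → F i ≤ a → F i ≤ F l) (r-min : ∀ i → a ≤ F i → F r ≤ F i) where

  private
    halve : ∀ {u v} → u ⊓ (T + T) ≡ v ⊓ (T + T) → u ⊓ T ≡ v ⊓ T
    halve = ⊓-≡-weaken (m≤m+n T T)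

    mono : ∀ i j → F i ≤ F j → F' i ≤ F' j
    mono = DistEq-≤ (≤-trans T≥1 (m≤m+n T T)) D

    gap : ((a ∸ F l) + (F r ∸ a)) ⊓ (T + T) ≡ (F' r ∸ F' l) ⊓ (T + T)
    gap = trans (cong (_⊓ (T + T)) (∸-split Fl≤a a≤Fr)) (dist-eq D l r)

  DistEq-insert : ∀ x' → x' ≤ F' r ∸ F' l → x' ⊓ T ≡ (a ∸ F l) ⊓ T →
                  (F' r ∸ F' l ∸ x') ⊓ T ≡ (F r ∸ a) ⊓ T → DistEq T (a ∷ F) ((F' l + x') ∷ F')
  DistEq-insert x' x'≤ ex ey = mkDistEq dists
    where
    open ≡-Reasoning
    a' : ℕ
    a' = F' l + x'

    F'l≤a' : F' l ≤ a'
    F'l≤a' = m≤m+n (F' l) x'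

    a'≤F'r : a' ≤ F' r
    a'≤F'r = subst (a' ≤_) (m+[n∸m]≡n (mono l r (≤-trans Fl≤a a≤Fr))) (+-monoʳ-≤ (F' l) x'≤)

    side : ∀ j → (F j ≤ F l × F j ≤ a) ⊎ (F r ≤ F j × a ≤ F j)
    side j with F j ≤? a
    ... | yes le = inj₁ (l-max j le , le)
    ... | no nle = inj₂ (r-min j (<⇒≤ (≰⇒> nle)) , <⇒≤ (≰⇒> nle))

    above : ∀ j → (F j ∸ a) ⊓ T ≡ (F' j ∸ a') ⊓ T
    above j with side j
    ... | inj₁ (le , le') = cong (_⊓ T) (trans (m≤n⇒m∸n≡0 le') (sym (m≤n⇒m∸n≡0 (≤-trans (mono j l le) F'l≤a'))))
    ... | inj₂ (ge , ge') = begin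
      (F j ∸ a) ⊓ T                            ≡⟨ cong (_⊓ T) (∸-split a≤Fr ge) ⟨
      ((F r ∸ a) + (F j ∸ F r)) ⊓ T            ≡⟨ +-cong-⊓ T (sym ey) (halve (dist-eq D r j)) ⟩
      ((F' r ∸ F' l ∸ x') + (F' j ∸ F' r)) ⊓ T ≡⟨ cong (λ z → (z + (F' j ∸ F' r)) ⊓ T) (∸-+-assoc (F' r) (F' l) x') ⟩
      ((F' r ∸ a') + (F' j ∸ F' r)) ⊓ T        ≡⟨ cong (_⊓ T) (∸-split a'≤F'r (mono r j ge)) ⟩
      (F' j ∸ a') ⊓ T                          ∎

    below : ∀ j → (a ∸ F j) ⊓ T ≡ (a' ∸ F' j) ⊓ T
    below j with side j
    ... | inj₂ (ge , ge') = cong (_⊓ T) (trans (m≤n⇒m∸n≡0 ge') (sym (m≤n⇒m∸n≡0 (≤-trans a'≤F'r (mono r j ge)))))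
    ... | inj₁ (le , le') = begin
      (a ∸ F j) ⊓ T                      ≡⟨ cong (_⊓ T) (∸-split le Fl≤a) ⟨
      ((F l ∸ F j) + (a ∸ F l)) ⊓ T      ≡⟨ +-cong-⊓ T (halve (dist-eq D j l)) (sym ex) ⟩
      ((F' l ∸ F' j) + x') ⊓ T           ≡⟨ cong (λ z → ((F' l ∸ F' j) + z) ⊓ T) (m+n∸m≡n (F' l) x') ⟨
      ((F' l ∸ F' j) + (a' ∸ F' l)) ⊓ T  ≡⟨ cong (_⊓ T) (∸-split (mono j l le) F'l≤a') ⟩
      (a' ∸ F' j) ⊓ T                    ∎

    dists : ∀ i j → ((a ∷ F) j ∸ (a ∷ F) i) ⊓ T ≡ ((a' ∷ F') j ∸ (a' ∷ F') i) ⊓ T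
    dists zero    zero    = cong (_⊓ T) (trans (n∸n≡0 a) (sym (n∸n≡0 a')))
    dists zero    (suc j) = above j
    dists (suc i) zero    = below i
    dists (suc i) (suc j) = halve (dist-eq D i j)

  DistEq-extend-between : Σ ℕ λ a' → DistEq T (a ∷ F) (a' ∷ F')
  DistEq-extend-between with split-gap T (a ∸ F l) (F r ∸ a) (F' r ∸ F' l) gap
  ... | x' , x'≤ , ex , ey = F' l + x' , DistEq-insert x' x'≤ ex ey

DistEq-extend : ∀ {k} T → 1 ≤ T → {F F' : Fin k → ℕ} → DistEq (T + T) F F' →
                ∀ a {lo hi} → F lo ≤ a → a ≤ F hi → Σ ℕ λ a' → DistEq T (a ∷ F) (a' ∷ F')
DistEq-extend T T≥1 {F} D a lo≤a a≤hi =
  let (l , Fl≤a , l-max) = argmax F (λ i → F i ≤? a) lo≤a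
      (r , a≤Fr , r-min) = argmin F (λ i → a ≤? F i) a≤hi
  in DistEq-extend-between T T≥1 D Fl≤a a≤Fr l-max r-min

Agree : ∀ {k} → (ℕ → ℕ → Set) → (Fin k → ℕ) → (Fin k → ℕ) → Set
Agree R E E' = ∀ i j → R (E i) (E j) ⇔ R (E' i) (E' j)

Agree-at : ∀ {k} {R : ℕ → ℕ → Set} {E E' : Fin k → ℕ} → Agree R E E' →
           ∀ i j {u v u' v'} → E i ≡ u → E j ≡ v → E' i ≡ u' → E' j ≡ v' → R u v ⇔ R u' v'
Agree-at agree i j refl refl refl refl = agree i j

-- A variable at position i is recorded as i + 1, so that the markers 0 and N + 1 lie strictly
-- outside the order; extra holds further marked positions.
positions : ∀ {n c} N → (Fin c → ℕ) → Assignment n N → Fin (n + (2 + c)) → ℕ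
positions N extra ρ = (λ i → suc (toℕ (ρ i))) ++ (0 ∷ suc N ∷ extra)

module _ {n c N} (extra : Fin c → ℕ) (ρ : Assignment n N) where
  private
    markers : Fin (2 + c) → ℕ
    markers = 0 ∷ suc N ∷ extra

  positions-var : ∀ x → positions N extra ρ (x ↑ˡ (2 + c)) ≡ suc (toℕ (ρ x))
  positions-var = lookup-++ˡ (λ i → suc (toℕ (ρ i))) markers

  positions-bottom : positions N extra ρ (n ↑ʳ zero) ≡ 0
  positions-bottom = lookup-++ʳ (λ i → suc (toℕ (ρ i))) markers zero

  positions-top : positions N extra ρ (n ↑ʳ suc zero) ≡ suc N
  positions-top = lookup-++ʳ (λ i → suc (toℕ (ρ i))) markers (suc zero)

  positions-extra : ∀ j → positions N extra ρ (n ↑ʳ suc (suc j)) ≡ extra j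
  positions-extra j = lookup-++ʳ (λ i → suc (toℕ (ρ i))) markers (suc (suc j))

  positions-∷ : ∀ a → positions N extra (a ∷ₐ ρ) ≗ suc (toℕ a) ∷ positions N extra ρ
  positions-∷ a zero    = refl
  positions-∷ a (suc i) = [,]-map (splitAt n i)

positions-extend : ∀ {n c N N'} {extra extra' : Fin c → ℕ} T → 1 ≤ T →
                   {ρ : Assignment n N} {ρ' : Assignment n N'} →
                   DistEq (T + T) (positions N extra ρ) (positions N' extra' ρ') → (a : Fin N) →
                   Σ (Fin N') λ a' → DistEq T (positions N extra (a ∷ₐ ρ)) (positions N' extra' (a' ∷ₐ ρ'))
positions-extend {n} {N = N} {N'} {extra} {extra'} T T≥1 {ρ} {ρ'} D a
  with DistEq-extend T T≥1 D (suc (toℕ a)) {n ↑ʳ zero} {n ↑ʳ suc zero}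
         (subst (_≤ suc (toℕ a)) (sym (positions-bottom extra ρ)) z≤n)
         (subst (suc (toℕ a) ≤_) (sym (positions-top extra ρ)) (s≤s (<⇒≤ (FP.toℕ<n a))))
... | zero , D' = ⊥-elim (n≮0 (to (Agree-at {R = _<_} (DistEq-<⇔ T≥1 D') (suc (n ↑ʳ zero)) zero
                    (positions-bottom extra ρ) refl (positions-bottom extra' ρ') refl) z<s))
... | suc p , D' = F.fromℕ< p<N' , DistEq-cong (sym ∘ positions-∷ extra ρ a) new D'
  where
  p<N' : p < N'
  p<N' = s<s⁻¹ (to (Agree-at {R = _<_} (DistEq-<⇔ T≥1 D') zero (suc (n ↑ʳ suc zero))
           refl (positions-top extra ρ) refl (positions-top extra' ρ')) (s<s (FP.toℕ<n a)))
  new : suc p ∷ positions N' extra' ρ' ≗ positions N' extra' (F.fromℕ< p<N' ∷ₐ ρ')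
  new zero    = cong suc (sym (FP.toℕ-fromℕ< p<N'))
  new (suc i) = sym (positions-∷ extra' ρ' _ (suc i))

suc-<⇔ : ∀ {m n} → (m < n) ⇔ (suc m < suc n)
suc-<⇔ = mk⇔ s<s s<s⁻¹

Fin-≡⇔ : ∀ {N} {x y : Fin N} → (x ≡ y) ⇔ (suc (toℕ x) ≡ suc (toℕ y))
Fin-≡⇔ = mk⇔ (cong (suc ∘ toℕ)) (FP.toℕ-injective ∘ suc-injective)

Agree-vars : ∀ {n c N N'} {extra extra' : Fin c → ℕ} R {ρ : Assignment n N} {ρ' : Assignment n N'} →
             Agree R (positions N extra ρ) (positions N' extra' ρ') → ∀ x y →
             R (suc (toℕ (ρ x))) (suc (toℕ (ρ y))) ⇔ R (suc (toℕ (ρ' x))) (suc (toℕ (ρ' y)))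
Agree-vars {N = N} {N'} {extra} {extra'} R {ρ} {ρ'} agree x y =
  Agree-at {R = R} {positions N extra ρ} {positions N' extra' ρ'} agree (x ↑ˡ _) (y ↑ˡ _)
    (positions-var extra ρ x) (positions-var extra ρ y) (positions-var extra' ρ' x) (positions-var extra' ρ' y)

Agree-var-extra : ∀ {n c N N'} {extra extra' : Fin c → ℕ} R {ρ : Assignment n N} {ρ' : Assignment n N'} →
                  Agree R (positions N extra ρ) (positions N' extra' ρ') → ∀ x j →
                  R (suc (toℕ (ρ x))) (extra j) ⇔ R (suc (toℕ (ρ' x))) (extra' j)
Agree-var-extra {n} {N = N} {N'} {extra} {extra'} R {ρ} {ρ'} agree x j =
  Agree-at {R = R} {positions N extra ρ} {positions N' extra' ρ'} agree (x ↑ˡ _) (n ↑ʳ suc (suc j))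
    (positions-var extra ρ x) (positions-extra extra ρ j) (positions-var extra' ρ' x) (positions-extra extra' ρ' j)

positions-<⇔ : ∀ {n c N N'} {extra extra' : Fin c → ℕ} {ρ : Assignment n N} {ρ' : Assignment n N'} →
               Agree _<_ (positions N extra ρ) (positions N' extra' ρ') → ∀ x y → (ρ x F.< ρ y) ⇔ (ρ' x F.< ρ' y)
positions-<⇔ agree x y = suc-<⇔ ⟨⇔⟩ Agree-vars _<_ agree x y ⟨⇔⟩ ⇔-sym suc-<⇔

module _ {c N N'} (σ : Perm N) (τ : Perm N') (extra extra' : Fin c → ℕ)
  (<V-agree : ∀ {n} (ρ : Assignment n N) (ρ' : Assignment n N') →
              Agree _<_ (positions N extra ρ) (positions N' extra' ρ') → ∀ x y →
              (fun σ (ρ x) F.< fun σ (ρ y)) ⇔ (fun τ (ρ' x) F.< fun τ (ρ' y))) where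

  -- With q rounds left distances are compared up to 2 ^ q; halving the threshold leaves room to
  -- answer any new point between the images of its neighbours.
  DistGame : ℕ → ∀ {n} → Assignment n N → Assignment n N' → Set
  DistGame q ρ ρ' = DistEq (2 ^ q) (positions N extra ρ) (positions N' extra' ρ')

  private
    2^q≥1 : ∀ q → 1 ≤ 2 ^ q
    2^q≥1 = m^n>0 2

    halve : ∀ q {k} {E E' : Fin k → ℕ} → DistEq (2 ^ suc q) E E' → DistEq (2 ^ q + 2 ^ q) E E'
    halve q {E = E} {E'} = subst (λ T → DistEq T E E') (cong (2 ^ q +_) (+-identityʳ (2 ^ q)))

  distBackAndForth : BackAndForth σ τ DistGame
  distBackAndForth = record
    { ≐-agree  = λ {q} r x y → Fin-≡⇔ ⟨⇔⟩ Agree-vars _≡_ (DistEq-≡⇔ (2^q≥1 q) r) x y ⟨⇔⟩ ⇔-sym Fin-≡⇔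
    ; <P-agree = λ {q} r → positions-<⇔ (DistEq-<⇔ (2^q≥1 q) r)
    ; <V-agree = λ {q} {ρ = ρ} {ρ'} r → <V-agree ρ ρ' (DistEq-<⇔ (2^q≥1 q) r)
    ; forth    = λ {q} r → positions-extend (2 ^ q) (2^q≥1 q) (halve q r)
    ; back     = λ {q} r a' → let (a , r') = positions-extend (2 ^ q) (2^q≥1 q) (halve q (DistEq-sym r)) a'
                              in a , DistEq-sym r'
    }

  sentence-transfer : (ψ : Sentence) → DistEq (2 ^ rank ψ) (0 ∷ suc N ∷ extra) (0 ∷ suc N' ∷ extra') →
                      (σ ⊨ₛ ψ) ⇔ (τ ⊨ₛ ψ)
  sentence-transfer ψ = transfer distBackAndForth (rank ψ) ψ ≤-refl

-- The permutations δ k and 321[ι m, 1, ι n]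

opposite-<⇔ : ∀ {K} (i j : Fin K) → (opposite i F.< opposite j) ⇔ (j F.< i)
opposite-<⇔ {K} i j = mk⇔ reflect preserve
  where
  preserve : j F.< i → opposite i F.< opposite j
  preserve lt = subst₂ _<_ (sym (FP.opposite-prop i)) (sym (FP.opposite-prop j))
                  (∸-monoʳ-< (s<s lt) (FP.toℕ<n i))
  reflect : opposite i F.< opposite j → j F.< i
  reflect lt = ≰⇒> λ i≤j → <⇒≱ (subst₂ _<_ (FP.opposite-prop i) (FP.opposite-prop j) lt)
                              (∸-monoʳ-≤ K (s≤s i≤j))

δ≼δ-suc : ∀ K → δ K ≼ δ (suc K)
δ≼δ-suc K = suc , (λ _ _ → s<s) , λ i j →
  mk⇔ (subst₂ _<_ (sym (FP.toℕ-inject₁ (opposite i))) (sym (FP.toℕ-inject₁ (opposite j))))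
      (subst₂ _<_ (FP.toℕ-inject₁ (opposite i)) (FP.toℕ-inject₁ (opposite j)))

δ-fixed-point-odd : ∀ {K} (a : Fin K) → IsFixedPoint (δ K) a → K ≡ suc (toℕ a + toℕ a)
δ-fixed-point-odd {K} a e = begin
  K                                 ≡⟨ m∸n+n≡m (FP.toℕ<n a) ⟨
  K ∸ suc (toℕ a) + suc (toℕ a)     ≡⟨ cong (_+ suc (toℕ a)) (trans (sym (FP.opposite-prop a)) (cong toℕ e)) ⟩
  toℕ a + suc (toℕ a)               ≡⟨ +-suc (toℕ a) (toℕ a) ⟩
  suc (toℕ a + toℕ a)               ∎
  where open ≡-Reasoning

δ-even-no-fixed-point : ∀ T → ¬ HasFixedPoint (δ (T + T))
δ-even-no-fixed-point T (a , e) = even≢odd T (toℕ a)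
  (trans (cong (T +_) (+-identityʳ T))
    (trans (δ-fixed-point-odd a e) (cong (λ z → suc (toℕ a + z)) (sym (+-identityʳ (toℕ a))))))

δ-odd-fixed-point : ∀ T → HasFixedPoint (δ (suc (T + T)))
δ-odd-fixed-point T = middle , FP.toℕ-injective (begin
  toℕ (opposite middle)            ≡⟨ FP.opposite-prop middle ⟩
  suc (T + T) ∸ suc (toℕ middle)   ≡⟨ cong (λ z → T + T ∸ z) (FP.toℕ-fromℕ< T<2T+1) ⟩
  T + T ∸ T                        ≡⟨ m+n∸m≡n T T ⟩
  T                                ≡⟨ FP.toℕ-fromℕ< T<2T+1 ⟨
  toℕ middle                       ∎)
  where
  open ≡-Reasoning
  T<2T+1 : T < suc (T + T)
  T<2T+1 = s≤s (m≤m+n T T)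
  middle : Fin (suc (T + T))
  middle = F.fromℕ< T<2T+1

p321-top : ∀ m n (u : Fin m) → toℕ (p321-fun m n (u ↑ˡ suc n)) ≡ suc n + toℕ u
p321-top m n u rewrite FP.splitAt-↑ˡ m u (suc n) =
  trans (FP.toℕ-cast _ (suc n ↑ʳ u)) (FP.toℕ-↑ʳ (suc n) u)

p321-middle : ∀ m n → toℕ (p321-fun m n (m ↑ʳ zero)) ≡ n
p321-middle m n rewrite FP.splitAt-↑ʳ m (suc n) zero =
  trans (FP.toℕ-cast _ (F.fromℕ n ↑ˡ m)) (trans (FP.toℕ-↑ˡ (F.fromℕ n) m) (FP.toℕ-fromℕ n))

p321-bottom : ∀ m n (v : Fin n) → toℕ (p321-fun m n (m ↑ʳ suc v)) ≡ toℕ v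
p321-bottom m n v rewrite FP.splitAt-↑ʳ m (suc n) (suc v) =
  trans (FP.toℕ-cast _ (F.inject₁ v ↑ˡ m)) (trans (FP.toℕ-↑ˡ (F.inject₁ v) m) (FP.toℕ-inject₁ v))

↑ˡ-<⇔ : ∀ {m} n {u u' : Fin m} → (u ↑ˡ n) F.< (u' ↑ˡ n) ⇔ u F.< u'
↑ˡ-<⇔ n {u} {u'} = mk⇔ (subst₂ _<_ (FP.toℕ-↑ˡ u n) (FP.toℕ-↑ˡ u' n))
                       (subst₂ _<_ (sym (FP.toℕ-↑ˡ u n)) (sym (FP.toℕ-↑ˡ u' n)))

↑ʳ-<⇔ : ∀ m {n} {v v' : Fin n} → (m ↑ʳ v) F.< (m ↑ʳ v') ⇔ v F.< v'
↑ʳ-<⇔ m {v = v} {v'} = mk⇔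
  (λ lt → +-cancelˡ-< m _ _ (subst₂ _<_ (FP.toℕ-↑ʳ m v) (FP.toℕ-↑ʳ m v') lt))
  (λ lt → subst₂ _<_ (sym (FP.toℕ-↑ʳ m v)) (sym (FP.toℕ-↑ʳ m v')) (+-monoʳ-< m lt))

↑ˡ<↑ʳ : ∀ {m n} (u : Fin m) (v : Fin n) → (u ↑ˡ n) F.< (m ↑ʳ v)
↑ˡ<↑ʳ {m} {n} u v = subst₂ _<_ (sym (FP.toℕ-↑ˡ u n)) (sym (FP.toℕ-↑ʳ m v)) (<-≤-trans (FP.toℕ<n u) (m≤m+n m (toℕ v)))

data SplitView (m n : ℕ) : Fin (m + n) → Set where
  left  : (u : Fin m) → SplitView m n (u ↑ˡ n)
  right : (v : Fin n) → SplitView m n (m ↑ʳ v)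

split-view : ∀ m n (i : Fin (m + n)) → SplitView m n i
split-view m n i with splitAt m i | FP.join-splitAt m n i
... | inj₁ u | refl = left u
... | inj₂ v | refl = right v

data Block321View (m n : ℕ) : Fin (m + suc n) → Set where
  top    : (u : Fin m) → Block321View m n (u ↑ˡ suc n)
  middle : Block321View m n (m ↑ʳ zero)
  bottom : (v : Fin n) → Block321View m n (m ↑ʳ suc v)

block321-view : ∀ m n (i : Fin (m + suc n)) → Block321View m n i
block321-view m n i with split-view m (suc n) i
... | left u        = top u
... | right zero    = middle
... | right (suc v) = bottom v

-- 2, 1 and 0 for the top block (positions < c), the middle point and the bottom block of
-- 321[ι c, 1, ι n], so that blocks with higher values get higher numbers.
block : ℕ → ℕ → ℕ
block c x with <-cmp x c
... | tri< _ _ _ = 2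
... | tri≈ _ _ _ = 1
... | tri> _ _ _ = 0

Order321 : ℕ → ℕ → ℕ → Set
Order321 c x y = block c x < block c y ⊎ (block c x ≡ block c y × x < y)

block-cong : ∀ {c a a'} → (a < c) ⇔ (a' < c) → (c < a) ⇔ (c < a') → block c a ≡ block c a'
block-cong {c} {a} {a'} below above with <-cmp a c | <-cmp a' c
... | tri< _ _ _ | tri< _ _ _ = refl
... | tri≈ _ _ _ | tri≈ _ _ _ = refl
... | tri> _ _ _ | tri> _ _ _ = refl
... | tri< x _ _ | tri≈ y _ _ = ⊥-elim (y (to below x))
... | tri< x _ _ | tri> y _ _ = ⊥-elim (y (to below x))
... | tri≈ x _ _ | tri< y _ _ = ⊥-elim (x (from below y))
... | tri≈ _ _ x | tri> _ _ y = ⊥-elim (x (from above y))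
... | tri> x _ _ | tri< y _ _ = ⊥-elim (x (from below y))
... | tri> _ _ x | tri≈ _ _ y = ⊥-elim (y (to above x))

Order321-cong : ∀ {c a b a' b'} → block c a ≡ block c a' → block c b ≡ block c b' → (a < b) ⇔ (a' < b') →
                Order321 c a b ⇔ Order321 c a' b'
Order321-cong {c} {a} {b} {a'} {b'} ea eb a<b = mk⇔ (transport ea eb (to a<b)) (transport (sym ea) (sym eb) (from a<b))
  where
  transport : ∀ {a b a' b'} → block c a ≡ block c a' → block c b ≡ block c b' → (a < b → a' < b') →
              Order321 c a b → Order321 c a' b'
  transport ea eb f (inj₁ lt)      = inj₁ (subst₂ _<_ ea eb lt)
  transport ea eb f (inj₂ (e , lt)) = inj₂ (trans (sym ea) (trans e eb) , f lt)

Order321-trichotomy : ∀ c x y → Order321 c x y ⊎ x ≡ y ⊎ Order321 c y x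
Order321-trichotomy c x y with <-cmp (block c x) (block c y)
... | tri< lt _ _ = inj₁ (inj₁ lt)
... | tri> _ _ gt = inj₂ (inj₂ (inj₁ gt))
... | tri≈ _ e _ with <-cmp x y
...   | tri< lt _ _ = inj₁ (inj₂ (e , lt))
...   | tri≈ _ e' _ = inj₂ (inj₁ e')
...   | tri> _ _ gt = inj₂ (inj₂ (inj₂ (sym e , gt)))

module _ (m n : ℕ) where

  block-top : ∀ u → block m (toℕ (u ↑ˡ suc n)) ≡ 2
  block-top u with <-cmp (toℕ (u ↑ˡ suc n)) m
  ... | tri< _ _ _ = refl
  ... | tri≈ ¬lt _ _ = ⊥-elim (¬lt (subst (_< m) (sym (FP.toℕ-↑ˡ u (suc n))) (FP.toℕ<n u)))
  ... | tri> ¬lt _ _ = ⊥-elim (¬lt (subst (_< m) (sym (FP.toℕ-↑ˡ u (suc n))) (FP.toℕ<n u)))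

  block-middle : block m (toℕ (m ↑ʳ zero {n})) ≡ 1
  block-middle with <-cmp (toℕ (m ↑ʳ zero {n})) m
  ... | tri≈ _ _ _ = refl
  ... | tri< _ ¬e _ = ⊥-elim (¬e (trans (FP.toℕ-↑ʳ m (zero {n})) (+-identityʳ m)))
  ... | tri> _ ¬e _ = ⊥-elim (¬e (trans (FP.toℕ-↑ʳ m (zero {n})) (+-identityʳ m)))

  block-bottom : ∀ v → block m (toℕ (m ↑ʳ suc {n} v)) ≡ 0
  block-bottom v with <-cmp (toℕ (m ↑ʳ suc {n} v)) m
  ... | tri> _ _ _ = refl
  ... | tri< _ _ ¬gt = ⊥-elim (¬gt (subst (m <_) (sym (FP.toℕ-↑ʳ m (suc v))) (m<m+n m z<s)))
  ... | tri≈ _ _ ¬gt = ⊥-elim (¬gt (subst (m <_) (sym (FP.toℕ-↑ʳ m (suc v))) (m<m+n m z<s)))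

  record Shaped321 (f : Fin (m + suc n) → ℕ) : Set where
    field
      top-increasing    : ∀ u u' → u F.< u' → f (u ↑ˡ suc n) < f (u' ↑ˡ suc n)
      bottom-increasing : ∀ v v' → v F.< v' → f (m ↑ʳ suc v) < f (m ↑ʳ suc v')
      middle<top        : ∀ u → f (m ↑ʳ zero) < f (u ↑ˡ suc n)
      bottom<middle     : ∀ v → f (m ↑ʳ suc v) < f (m ↑ʳ zero)

  private
    same-block : ∀ {x y b} → block m x ≡ b → block m y ≡ b → Order321 m x y → x < y
    same-block ex ey (inj₁ lt)       = ⊥-elim (<-irrefl (trans ex (sym ey)) lt)
    same-block ex ey (inj₂ (_ , lt)) = lt

    wrong-way : ∀ {x y bx by} → block m x ≡ bx → block m y ≡ by → by < bx → ¬ Order321 m x y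
    wrong-way refl refl gt (inj₁ lt)      = <-asym lt gt
    wrong-way refl refl gt (inj₂ (e , _)) = <-irrefl (sym e) gt

  module _ {f} (shaped : Shaped321 f) where
    open Shaped321 shaped

    Order321⇒< : ∀ i j → Order321 m (toℕ i) (toℕ j) → f i < f j
    Order321⇒< i j ord with block321-view m n i | block321-view m n j
    ... | top u    | top u'   = top-increasing u u' (to (↑ˡ-<⇔ (suc n)) (same-block (block-top u) (block-top u') ord))
    ... | bottom v | bottom v' = bottom-increasing v v' (s<s⁻¹ (to (↑ʳ-<⇔ m) (same-block (block-bottom v) (block-bottom v') ord)))
    ... | middle   | top u    = middle<top u
    ... | bottom v | middle   = bottom<middle v
    ... | bottom v | top u    = <-trans (bottom<middle v) (middle<top u)
    ... | middle   | middle   = ⊥-elim (<-irrefl refl (same-block block-middle block-middle ord))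
    ... | top u    | middle   = ⊥-elim (wrong-way (block-top u) block-middle (s<s z<s) ord)
    ... | top u    | bottom v = ⊥-elim (wrong-way (block-top u) (block-bottom v) z<s ord)
    ... | middle   | bottom v = ⊥-elim (wrong-way block-middle (block-bottom v) z<s ord)

    Shaped321-<⇔ : ∀ i j → (f i < f j) ⇔ Order321 m (toℕ i) (toℕ j)
    Shaped321-<⇔ i j = mk⇔ reflect (Order321⇒< i j)
      where
      reflect : f i < f j → Order321 m (toℕ i) (toℕ j)
      reflect lt with Order321-trichotomy m (toℕ i) (toℕ j)
      ... | inj₁ ord        = ord
      ... | inj₂ (inj₁ e)   = ⊥-elim (<-irrefl (cong f (FP.toℕ-injective e)) lt)
      ... | inj₂ (inj₂ ord) = ⊥-elim (<-asym lt (Order321⇒< j i ord))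

  p321-shaped : Shaped321 (λ i → toℕ (p321-fun m n i))
  p321-shaped = record
    { top-increasing    = λ u u' lt → subst₂ _<_ (sym (p321-top m n u)) (sym (p321-top m n u')) (+-monoʳ-< (suc n) lt)
    ; bottom-increasing = λ v v' lt → subst₂ _<_ (sym (p321-bottom m n v)) (sym (p321-bottom m n v')) lt
    ; middle<top        = λ u → subst₂ _<_ (sym (p321-middle m n)) (sym (p321-top m n u)) (s≤s (m≤m+n n (toℕ u)))
    ; bottom<middle     = λ v → subst₂ _<_ (sym (p321-bottom m n v)) (sym (p321-middle m n)) (FP.toℕ<n v)
    }

  p321-<⇔ : ∀ i j → (fun (p321 m n) i F.< fun (p321 m n) j) ⇔ Order321 m (toℕ i) (toℕ j)
  p321-<⇔ = Shaped321-<⇔ p321-shaped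

p321≼p321-suc : ∀ m n → p321 m n ≼ p321 m (suc n)
p321≼p321-suc m n = e , (λ i j → subst₂ _<_ (sym (toℕ-e i)) (sym (toℕ-e j))) , λ i j →
  p321-<⇔ m n i j ⟨⇔⟩ Order321-cong (cong (block m) (sym (toℕ-e i))) (cong (block m) (sym (toℕ-e j)))
                                    (mk⇔ (subst₂ _<_ (sym (toℕ-e i)) (sym (toℕ-e j))) (subst₂ _<_ (toℕ-e i) (toℕ-e j)))
                  ⟨⇔⟩ ⇔-sym (p321-<⇔ m (suc n) (e i) (e j))
  where
  le : m + suc n ≤ m + suc (suc n)
  le = +-monoʳ-≤ m (n≤1+n (suc n))
  e : Fin (m + suc n) → Fin (m + suc (suc n))
  e i = F.inject≤ i le
  toℕ-e : ∀ i → toℕ (e i) ≡ toℕ i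
  toℕ-e i = FP.toℕ-inject≤ i le

p321-fixed-point : ∀ m → HasFixedPoint (p321 m m)
p321-fixed-point m = m ↑ʳ zero , FP.toℕ-injective
  (trans (p321-middle m m) (sym (trans (FP.toℕ-↑ʳ m (zero {m})) (+-identityʳ m))))

p321-fixed-point⇒≡ : ∀ {m n} → HasFixedPoint (p321 m n) → m ≡ n
p321-fixed-point⇒≡ {m} {n} (a , e) = at (block321-view m n a) (cong toℕ e)
  where
  at : ∀ {a} → Block321View m n a → toℕ (p321-fun m n a) ≡ toℕ a → m ≡ n
  at (top u) e = ⊥-elim (m≢1+n+m (toℕ u) (trans (sym (FP.toℕ-↑ˡ u (suc n))) (trans (sym e) (p321-top m n u))))
  at middle e = trans (sym (trans (FP.toℕ-↑ʳ m (zero {n})) (+-identityʳ m))) (trans (sym e) (p321-middle m n))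
  at (bottom v) e = ⊥-elim (<-irrefl (trans (sym (p321-bottom m n v)) (trans e (FP.toℕ-↑ʳ m (suc v))))
                                     (<-≤-trans (n<1+n (toℕ v)) (m≤n+m (suc (toℕ v)) m)))

δ-<V-agree : ∀ {k c K K'} {extra extra' : Fin c → ℕ} (ρ : Assignment k K) (ρ' : Assignment k K') →
             Agree _<_ (positions K extra ρ) (positions K' extra' ρ') → ∀ x y →
             (fun (δ K) (ρ x) F.< fun (δ K) (ρ y)) ⇔ (fun (δ K') (ρ' x) F.< fun (δ K') (ρ' y))
δ-<V-agree ρ ρ' agree x y =
  opposite-<⇔ (ρ x) (ρ y) ⟨⇔⟩ positions-<⇔ agree y x ⟨⇔⟩ ⇔-sym (opposite-<⇔ (ρ' x) (ρ' y))

-- The block of a position is read off by comparing it with the marker at position m.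
p321-<V-agree : ∀ m n n' {k} (ρ : Assignment k (m + suc n)) (ρ' : Assignment k (m + suc n')) →
                Agree _<_ (positions _ (suc m ∷ []) ρ) (positions _ (suc m ∷ []) ρ') → ∀ x y →
                (fun (p321 m n) (ρ x) F.< fun (p321 m n) (ρ y)) ⇔ (fun (p321 m n') (ρ' x) F.< fun (p321 m n') (ρ' y))
p321-<V-agree m n n' ρ ρ' agree x y =
  p321-<⇔ m n (ρ x) (ρ y) ⟨⇔⟩ Order321-cong (same-block x) (same-block y) (positions-<⇔ agree x y)
  ⟨⇔⟩ ⇔-sym (p321-<⇔ m n' (ρ' x) (ρ' y))
  where
  compare : ∀ z → (suc (toℕ (ρ z)) < suc m) ⇔ (suc (toℕ (ρ' z)) < suc m) ×
                  (suc m < suc (toℕ (ρ z))) ⇔ (suc m < suc (toℕ (ρ' z)))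
  compare z = Agree-var-extra _<_ agree z zero , Agree-var-extra (flip _<_) (λ i j → agree j i) z zero
  same-block : ∀ z → block m (toℕ (ρ z)) ≡ block m (toℕ (ρ' z))
  same-block z = block-cong (suc-<⇔ ⟨⇔⟩ proj₁ (compare z) ⟨⇔⟩ ⇔-sym suc-<⇔)
                            (suc-<⇔ ⟨⇔⟩ proj₂ (compare z) ⟨⇔⟩ ⇔-sym suc-<⇔)

δ-markers : ∀ {T N N'} → T ≤ N → T ≤ N' → DistEq T (0 ∷ suc N ∷ []) (0 ∷ suc N' ∷ [])
δ-markers {T} {N} {N'} T≤N T≤N' = mkDistEq dists
  where
  dists : ∀ i j → ((0 ∷ suc N ∷ []) j ∸ (0 ∷ suc N ∷ []) i) ⊓ T ≡ ((0 ∷ suc N' ∷ []) j ∸ (0 ∷ suc N' ∷ []) i) ⊓ T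
  dists zero       zero       = refl
  dists zero       (suc zero) = ⊓-≡-≥ (m≤n⇒m≤1+n T≤N) (m≤n⇒m≤1+n T≤N')
  dists (suc zero) zero       = refl
  dists (suc zero) (suc zero) = cong (_⊓ T) (trans (n∸n≡0 N) (sym (n∸n≡0 N')))

p321-markers : ∀ m n n' → m ≤ suc n → m ≤ suc n' →
               DistEq m (0 ∷ suc (m + suc n) ∷ suc m ∷ []) (0 ∷ suc (m + suc n') ∷ suc m ∷ [])
p321-markers m n n' m≤n m≤n' = mkDistEq dists
  where
  E E' : Fin 3 → ℕ
  E  = 0 ∷ suc (m + suc n) ∷ suc m ∷ []
  E' = 0 ∷ suc (m + suc n') ∷ suc m ∷ []
  dists : ∀ i j → (E j ∸ E i) ⊓ m ≡ (E' j ∸ E' i) ⊓ m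
  dists zero             zero             = refl
  dists zero             (suc zero)       = ⊓-≡-≥ (≤-trans (m≤m+n m (suc n)) (n≤1+n _)) (≤-trans (m≤m+n m (suc n')) (n≤1+n _))
  dists zero             (suc (suc zero)) = refl
  dists (suc zero)       zero             = refl
  dists (suc zero)       (suc zero)       = cong (_⊓ m) (trans (n∸n≡0 (m + suc n)) (sym (n∸n≡0 (m + suc n'))))
  dists (suc zero)       (suc (suc zero)) = cong (_⊓ m) (trans (m≤n⇒m∸n≡0 (m≤m+n m (suc n))) (sym (m≤n⇒m∸n≡0 (m≤m+n m (suc n')))))
  dists (suc (suc zero)) zero             = refl
  dists (suc (suc zero)) (suc zero)       = ⊓-≡-≥ (subst (m ≤_) (sym (m+n∸m≡n m (suc n))) m≤n) (subst (m ≤_) (sym (m+n∸m≡n m (suc n'))) m≤n')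
  dists (suc (suc zero)) (suc (suc zero)) = cong (_⊓ m) (trans (n∸n≡0 m) (sym (n∸n≡0 m)))

PermClass : Set₁
PermClass = ∀ {N} → Perm N → Set

SentenceDefinesFixedPoints : PermClass → Sentence → Set
SentenceDefinesFixedPoints C ψ = ∀ {N} (σ : Perm N) → C σ → (σ ⊨ₛ ψ) ⇔ HasFixedPoint σ

FormulaDefinesFixedPoints : PermClass → Formula 1 → Set
FormulaDefinesFixedPoints C φ = ∀ {N} (σ : Perm N) → C σ → (a : Fin N) → (σ , a ⊨₁ φ) ⇔ IsFixedPoint σ a

Avoids321Patterns : PermClass → Set
Avoids321Patterns C = Σ ℕ λ k → Σ ℕ λ m → Σ ℕ λ n → 0 < k × 0 < m × 0 < n × ¬ C (δ k) × ¬ C (p321 m n)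

separated⇒∉ : ∀ {C : PermClass} {ψ} → IsPermClass C → SentenceDefinesFixedPoints C ψ →
              ∀ {r N} {π : Perm r} {σ : Perm N} → π ≼ σ → (π ⊨ₛ ψ) ⇔ (σ ⊨ₛ ψ) →
              ¬ (HasFixedPoint π ⇔ HasFixedPoint σ) → ¬ C σ
separated⇒∉ closed defines π≼σ same-truth differ Cσ =
  differ (⇔-sym (defines _ (closed _ _ Cσ π≼σ)) ⟨⇔⟩ same-truth ⟨⇔⟩ defines _ Cσ)

sentence⇒avoids : ∀ (C : PermClass) → IsPermClass C → ∀ {ψ} → SentenceDefinesFixedPoints C ψ → Avoids321Patterns C
sentence⇒avoids C closed {ψ} defines = suc (T + T) , T , suc T , z<s , m^n>0 2 (rank ψ) , z<s , ¬δ , ¬p321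
  where
  T : ℕ
  T = 2 ^ rank ψ

  ¬δ : ¬ C (δ (suc (T + T)))
  ¬δ = separated⇒∉ closed defines (δ≼δ-suc (T + T))
         (sentence-transfer (δ (T + T)) (δ (suc (T + T))) [] [] δ-<V-agree ψ
           (δ-markers (m≤m+n T T) (m≤n⇒m≤1+n (m≤m+n T T))))
         (λ same → δ-even-no-fixed-point T (from same (δ-odd-fixed-point T)))

  ¬p321 : ¬ C (p321 T (suc T))
  ¬p321 = separated⇒∉ closed defines (p321≼p321-suc T T)
            (sentence-transfer (p321 T T) (p321 T (suc T)) (suc T ∷ []) (suc T ∷ []) (p321-<V-agree T T (suc T)) ψ
              (p321-markers T T (suc T) (n≤1+n T) (m≤n⇒m≤1+n (n≤1+n T))))
            (λ same → <-irrefl (p321-fixed-point⇒≡ (to same (p321-fixed-point T))) (n<1+n T))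

-- Counting

indicator : ∀ {P : Set} → Dec P → ℕ
indicator (yes _) = 1
indicator (no _)  = 0

indicator-yes : ∀ {P : Set} → P → (d : Dec P) → indicator d ≡ 1
indicator-yes p (yes _) = refl
indicator-yes p (no ¬p) = ⊥-elim (¬p p)

indicator-no : ∀ {P : Set} → ¬ P → (d : Dec P) → indicator d ≡ 0
indicator-no ¬p (yes p) = ⊥-elim (¬p p)
indicator-no ¬p (no _)  = refl

indicator-cong : ∀ {P Q : Set} → (P ⇔ Q) → (p : Dec P) (q : Dec Q) → indicator p ≡ indicator q
indicator-cong e (yes p) q = sym (indicator-yes (to e p) q)
indicator-cong e (no ¬p) q = sym (indicator-no (¬p ∘ from e) q)

indicator-mono : ∀ {P Q : Set} → (P → Q) → (p : Dec P) (q : Dec Q) → indicator p ≤ indicator q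
indicator-mono f (yes p) q = ≤-reflexive (sym (indicator-yes (f p) q))
indicator-mono f (no _)  q = z≤n

indicator-⊎ : ∀ {P Q R : Set} → (P ⇔ (Q ⊎ R)) → (Q → ¬ R) → (p : Dec P) (q : Dec Q) (r : Dec R) →
              indicator p ≡ indicator q + indicator r
indicator-⊎ e disj p (yes q) (yes r) = ⊥-elim (disj q r)
indicator-⊎ e disj p (yes q) (no _)  = indicator-yes (from e (inj₁ q)) p
indicator-⊎ e disj p (no _)  (yes r) = indicator-yes (from e (inj₂ r)) p
indicator-⊎ e disj p (no ¬q) (no ¬r) = indicator-no ([ ¬q , ¬r ]′ ∘ to e) p

sum-mono : ∀ {N} {u v : Fin N → ℕ} → (∀ x → u x ≤ v x) → sum u ≤ sum v
sum-mono {zero}  p = z≤n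
sum-mono {suc N} p = +-mono-≤ (p zero) (sum-mono (p ∘ suc))

sum-∘-injective : ∀ {N} (π : Fin N → Fin N) → Injective _≡_ _≡_ π → (u : Fin N → ℕ) → sum (u ∘ π) ≡ sum u
sum-∘-injective {zero}  π inj u = refl
sum-∘-injective {suc N} π inj u = begin
  u (π zero) + sum (u ∘ π ∘ suc)                        ≡⟨ cong (u (π zero) +_) (sum-cong-≗ λ i → cong u (sym (FP.punchIn-punchOut (π₀≢ i)))) ⟩
  u (π zero) + sum (u ∘ punchIn (π zero) ∘ π′)          ≡⟨ cong (u (π zero) +_) (sum-∘-injective π′ π′-injective (u ∘ punchIn (π zero))) ⟩
  u (π zero) + sum (u ∘ punchIn (π zero))               ≡⟨ sum-remove {i = π zero} u ⟨
  sum u                                                 ∎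
  where
  open ≡-Reasoning
  π₀≢ : ∀ i → π zero ≢ π (suc i)
  π₀≢ i e with inj e
  ... | ()
  π′ : Fin N → Fin N
  π′ i = punchOut (π₀≢ i)
  π′-injective : Injective _≡_ _≡_ π′
  π′-injective {i} {j} e = FP.suc-injective (inj (FP.punchOut-injective (π₀≢ i) (π₀≢ j) e))

count : ∀ {N} {Q : Fin N → Set} → (∀ x → Dec (Q x)) → ℕ
count Q? = sum (λ x → indicator (Q? x))

module _ {N} {Q : Fin N → Set} (Q? : ∀ x → Dec (Q x)) where

  count-mono : ∀ {Q' : Fin N → Set} (Q'? : ∀ x → Dec (Q' x)) → (∀ x → Q x → Q' x) → count Q? ≤ count Q'?
  count-mono Q'? f = sum-mono λ x → indicator-mono (f x) (Q? x) (Q'? x)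

  count-⊎ : ∀ {Q₁ Q₂ : Fin N → Set} (Q₁? : ∀ x → Dec (Q₁ x)) (Q₂? : ∀ x → Dec (Q₂ x)) →
            (∀ x → Q x ⇔ (Q₁ x ⊎ Q₂ x)) → (∀ x → Q₁ x → ¬ Q₂ x) → count Q? ≡ count Q₁? + count Q₂?
  count-⊎ Q₁? Q₂? e disj =
    trans (sum-cong-≗ {N} λ x → indicator-⊎ (e x) (disj x) (Q? x) (Q₁? x) (Q₂? x))
          (∑-distrib-+ (λ x → indicator (Q₁? x)) (λ x → indicator (Q₂? x)))

  count-positive : 1 ≤ count Q? → Σ (Fin N) Q
  count-positive = search (λ x → indicator (Q? x)) (λ x → witness (Q? x))
    where
    witness : ∀ {x} (d : Dec (Q x)) → 1 ≤ indicator d → Q x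
    witness (yes q) _ = q
    search : ∀ {k} (u : Fin k → ℕ) {P : Fin k → Set} → (∀ x → 1 ≤ u x → P x) → 1 ≤ sum u → Σ (Fin k) P
    search {suc k} u pos le with u zero in eq
    ... | suc _ = zero , pos zero (subst (1 ≤_) (sym eq) (s≤s z≤n))
    ... | zero  = let (x , p) = search (u ∘ suc) (pos ∘ suc) le in suc x , p

count-< : ∀ N b → b ≤ N → count {N} (λ x → toℕ x <? b) ≡ b
count-< zero    zero    z≤n = refl
count-< (suc N) zero    _   = trans (sum-cong-≗ {suc N} λ x → indicator-no (λ ()) (toℕ x <? 0)) (sum-replicate-zero (suc N))
count-< (suc N) (suc b) (s≤s b≤N) = cong₂ _+_ (indicator-yes z<s (0 <? suc b))
  (trans (sum-cong-≗ {N} λ x → indicator-cong (mk⇔ s<s⁻¹ s<s) (suc (toℕ x) <? suc b) (toℕ x <? b)) (count-< N b b≤N))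

count-≡ : ∀ {N} (z : Fin N) → count (λ w → w FP.≟ z) ≡ 1
count-≡ {suc N} z = trans (sum-remove {i = z} (λ w → indicator (w FP.≟ z)))
  (cong₂ _+_ (indicator-yes refl (z FP.≟ z))
    (trans (sum-cong-≗ {N} λ i → indicator-no (FP.punchInᵢ≢i z i) (punchIn z i FP.≟ z)) (sum-replicate-zero N)))

Chain : ∀ {N} → ℕ → (Fin N → Set) → Set
Chain zero    Q = ⊤
Chain {N} (suc c) Q = Σ (Fin N) λ z → Q z × Chain c (λ w → z F.< w × Q w)

Chain-map : ∀ {N} c {Q Q' : Fin N → Set} → (∀ w → Q w → Q' w) → Chain c Q → Chain c Q'
Chain-map zero    f _              = tt
Chain-map (suc c) f (z , qz , ch) = z , f z qz , Chain-map c (λ w (z<w , qw) → z<w , f w qw) ch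

module _ {N} {Q : Fin N → Set} (Q? : ∀ x → Dec (Q x)) where

  after? : (z : Fin N) → ∀ w → Dec (z F.< w × Q w)
  after? z w = (toℕ z <? toℕ w) ×-dec Q? w

  count-≡-after : (z : Fin N) →
                  count (λ w → (w FP.≟ z) ⊎-dec after? z w) ≡ suc (count (after? z))
  count-≡-after z = trans (count-⊎ (λ w → (w FP.≟ z) ⊎-dec after? z w) (λ w → w FP.≟ z) (after? z)
                             (λ _ → ⇔-id _) (λ { w refl (z<z , _) → <-irrefl refl z<z }))
                          (cong (_+ count (after? z)) (count-≡ z))

Chain⇒≤count : ∀ {N} c {Q : Fin N → Set} (Q? : ∀ x → Dec (Q x)) → Chain c Q → c ≤ count Q?
Chain⇒≤count zero    Q? _             = z≤n
Chain⇒≤count (suc c) Q? (z , qz , ch) = begin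
  suc c                                               ≤⟨ s≤s (Chain⇒≤count c (after? Q? z) ch) ⟩
  suc (count (after? Q? z))                           ≡⟨ count-≡-after Q? z ⟨
  count (λ w → (w FP.≟ z) ⊎-dec after? Q? z w)        ≤⟨ count-mono _ Q? (λ { w (inj₁ refl) → qz ; w (inj₂ (_ , qw)) → qw }) ⟩
  count Q?                                            ∎
  where open ≤-Reasoning

≤count⇒Chain : ∀ {N} c {Q : Fin N → Set} (Q? : ∀ x → Dec (Q x)) → c ≤ count Q? → Chain c Q
≤count⇒Chain zero    Q? _ = tt
≤count⇒Chain {N} (suc c) {Q} Q? le = z , qz , ≤count⇒Chain c (after? Q? z) (s≤s⁻¹ (begin
  suc c                                               ≤⟨ le ⟩
  count Q?                                            ≡⟨ count-⊎ Q? (λ w → w FP.≟ z) (after? Q? z) split disjoint ⟩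
  count (λ w → w FP.≟ z) + count (after? Q? z)        ≡⟨ cong (_+ count (after? Q? z)) (count-≡ z) ⟩
  suc (count (after? Q? z))                           ∎))
  where
  open ≤-Reasoning
  first : Σ (Fin N) λ z → Q z × (∀ w → Q w → toℕ z ≤ toℕ w)
  first = let (w , qw) = count-positive Q? (≤-trans (s≤s z≤n) le) in argmin toℕ Q? qw
  z : Fin N
  z = proj₁ first
  qz : Q z
  qz = proj₁ (proj₂ first)
  split : ∀ w → Q w ⇔ (w ≡ z ⊎ z F.< w × Q w)
  split w = mk⇔ (λ qw → case w FP.≟ z of λ where
                  (yes w≡z) → inj₁ w≡z
                  (no w≢z)  → inj₂ (≤∧≢⇒< (proj₂ (proj₂ first) w qw) (w≢z ∘ sym ∘ FP.toℕ-injective) , qw))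
                λ { (inj₁ refl) → qz ; (inj₂ (_ , qw)) → qw }
  disjoint : ∀ w → w ≡ z → ¬ (z F.< w × Q w)
  disjoint w refl (z<z , _) = <-irrefl refl z<z

exactly-Chain⇔ : ∀ {N} c {Q : Fin N → Set} (Q? : ∀ x → Dec (Q x)) →
                 (Chain c Q × ¬ Chain (suc c) Q) ⇔ (count Q? ≡ c)
exactly-Chain⇔ c Q? = mk⇔
  (λ (ch , ¬ch) → ≤-antisym (≮⇒≥ λ lt → ¬ch (≤count⇒Chain (suc c) Q? lt)) (Chain⇒≤count c Q? ch))
  (λ e → ≤count⇒Chain c Q? (≤-reflexive (sym e)) ,
         λ ch → <-irrefl refl (subst (suc c ≤_) e (Chain⇒≤count (suc c) Q? ch)))

-- Fixed points from quadrant counts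

module Quadrants {N} (σ : Perm N) (a : Fin N) where

  NW SE SW : Fin N → Set
  NW w = w F.< a × fun σ a F.< fun σ w
  SE w = a F.< w × fun σ w F.< fun σ a
  SW w = w F.< a × fun σ w F.< fun σ a

  NW? : ∀ w → Dec (NW w)
  NW? w = (toℕ w <? toℕ a) ×-dec (toℕ (fun σ a) <? toℕ (fun σ w))
  SE? : ∀ w → Dec (SE w)
  SE? w = (toℕ a <? toℕ w) ×-dec (toℕ (fun σ w) <? toℕ (fun σ a))
  SW? : ∀ w → Dec (SW w)
  SW? w = (toℕ w <? toℕ a) ×-dec (toℕ (fun σ w) <? toℕ (fun σ a))

  private
    compare : ∀ {x y : Fin N} → x ≢ y → x F.< y ⊎ y F.< x
    compare {x} {y} x≢y with <-cmp (toℕ x) (toℕ y)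
    ... | tri< lt _ _ = inj₁ lt
    ... | tri≈ _ e _  = ⊥-elim (x≢y (FP.toℕ-injective e))
    ... | tri> _ _ gt = inj₂ gt

    left-split : ∀ w → w F.< a ⇔ (SW w ⊎ NW w)
    left-split w = mk⇔
      (λ w<a → Sum.map (w<a ,_) (w<a ,_) (compare λ e → <-irrefl (cong toℕ (inj σ e)) w<a))
      [ proj₁ , proj₁ ]′

    below-split : ∀ w → fun σ w F.< fun σ a ⇔ (SW w ⊎ SE w)
    below-split w = mk⇔
      (λ σw<σa → Sum.map (_, σw<σa) (_, σw<σa) (compare λ { refl → <-irrefl refl σw<σa }))
      [ proj₂ , proj₂ ]′

  position≡ : toℕ a ≡ count SW? + count NW?
  position≡ = trans (sym (count-< N (toℕ a) (<⇒≤ (FP.toℕ<n a))))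
    (count-⊎ (λ w → toℕ w <? toℕ a) SW? NW? left-split (λ w (_ , lt) (_ , gt) → <-asym lt gt))

  value≡ : toℕ (fun σ a) ≡ count SW? + count SE?
  value≡ = begin
    toℕ (fun σ a)                                             ≡⟨ count-< N (toℕ (fun σ a)) (<⇒≤ (FP.toℕ<n (fun σ a))) ⟨
    count {N} (λ y → toℕ y <? toℕ (fun σ a))                  ≡⟨ sum-∘-injective (fun σ) (inj σ) (λ y → indicator (toℕ y <? toℕ (fun σ a))) ⟨
    count (λ w → toℕ (fun σ w) <? toℕ (fun σ a))              ≡⟨ count-⊎ _ SW? SE? below-split (λ w (lt , _) (gt , _) → <-asym lt gt) ⟩
    count SW? + count SE?                                     ∎
    where open ≡-Reasoning

  fixed-point⇔ : IsFixedPoint σ a ⇔ (count NW? ≡ count SE?)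
  fixed-point⇔ = mk⇔
    (λ e → +-cancelˡ-≡ (count SW?) _ _ (trans (sym position≡) (trans (cong toℕ (sym e)) value≡)))
    (λ e → FP.toℕ-injective (trans value≡ (trans (cong (count SW? +_) (sym e)) (sym position≡))))

module _ (atom : ∀ {n} → Fin n → Fin n → Formula n) where

  chainAbove : ℕ → ∀ {n} → Fin n → Fin n → Formula n
  chainAbove zero    p a = ⊤′
  chainAbove (suc c) p a = ∃′ ((suc p <P zero) ∧′ (atom zero (suc a) ∧′ chainAbove c zero (suc a)))

  chain : ℕ → ∀ {n} → Fin n → Formula n
  chain zero    a = ⊤′
  chain (suc c) a = ∃′ (atom zero (suc a) ∧′ chainAbove c zero (suc a))

  exactly : ℕ → ∀ {n} → Fin n → Formula n
  exactly c a = chain c a ∧′ (¬′ chain (suc c) a)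

module _ {N} (σ : Perm N) (atom : ∀ {n} → Fin n → Fin n → Formula n) (R : Fin N → Fin N → Set)
         (atom-sem : ∀ {n} (x y : Fin n) (ρ : Assignment n N) → (σ ⊨ atom x y [ ρ ]) ⇔ R (ρ x) (ρ y)) where

  chainAbove-sem : ∀ c {n} (p a : Fin n) (ρ : Assignment n N) →
                   (σ ⊨ chainAbove atom c p a [ ρ ]) ⇔ Chain c (λ w → ρ p F.< w × R w (ρ a))
  chainAbove-sem zero    p a ρ = mk⇔ (λ _ → tt) (λ _ ())
  chainAbove-sem (suc c) p a ρ = mk⇔
    (λ (z , p<z , r , h) → z , (p<z , to (atom-sem zero (suc a) (z ∷ₐ ρ)) r) ,
       Chain-map c (λ w (z<w , rw) → z<w , (<-trans p<z z<w , rw)) (to (chainAbove-sem c zero (suc a) (z ∷ₐ ρ)) h))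
    (λ (z , (p<z , r) , ch) → z , p<z , from (atom-sem zero (suc a) (z ∷ₐ ρ)) r ,
       from (chainAbove-sem c zero (suc a) (z ∷ₐ ρ)) (Chain-map c (λ w (z<w , (_ , rw)) → z<w , rw) ch))

  chain-sem : ∀ c {n} (a : Fin n) (ρ : Assignment n N) →
              (σ ⊨ chain atom c a [ ρ ]) ⇔ Chain c (λ w → R w (ρ a))
  chain-sem zero    a ρ = mk⇔ (λ _ → tt) (λ _ ())
  chain-sem (suc c) a ρ = mk⇔
    (λ (z , r , h) → z , to (atom-sem zero (suc a) (z ∷ₐ ρ)) r , to (chainAbove-sem c zero (suc a) (z ∷ₐ ρ)) h)
    (λ (z , r , ch) → z , from (atom-sem zero (suc a) (z ∷ₐ ρ)) r , from (chainAbove-sem c zero (suc a) (z ∷ₐ ρ)) ch)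

  exactly-sem : ∀ c {n} (a : Fin n) (ρ : Assignment n N) (R? : ∀ w → Dec (R w (ρ a))) →
                (σ ⊨ exactly atom c a [ ρ ]) ⇔ (count R? ≡ c)
  exactly-sem c a ρ R? = (chain-sem c a ρ ×-⇔ ¬-cong-⇔ (chain-sem (suc c) a ρ)) ⟨⇔⟩ exactly-Chain⇔ c R?

NW-atom SE-atom : ∀ {n} → Fin n → Fin n → Formula n
NW-atom w a = (w <P a) ∧′ (a <V w)
SE-atom w a = (a <P w) ∧′ (w <V a)

balanced : ℕ → Formula 1
balanced c = exactly NW-atom c zero ∧′ exactly SE-atom c zero

balancedUpTo : ℕ → Formula 1
balancedUpTo zero    = balanced zero
balancedUpTo (suc B) = balanced (suc B) ∨′ balancedUpTo B

module _ {N} (σ : Perm N) (a : Fin N) where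
  open Quadrants σ a

  balanced-sem : ∀ c → (σ , a ⊨₁ balanced c) ⇔ (count NW? ≡ c × count SE? ≡ c)
  balanced-sem c =
    exactly-sem σ NW-atom (λ w x → w F.< x × fun σ x F.< fun σ w) (λ _ _ _ → ⇔-id _) c zero (λ _ → a) NW? ×-⇔
    exactly-sem σ SE-atom (λ w x → x F.< w × fun σ w F.< fun σ x) (λ _ _ _ → ⇔-id _) c zero (λ _ → a) SE?

  balancedUpTo-sound : ∀ B → σ , a ⊨₁ balancedUpTo B → count NW? ≡ count SE?
  balancedUpTo-sound zero    h        = let (e , e') = to (balanced-sem zero) h in trans e (sym e')
  balancedUpTo-sound (suc B) (inj₁ h) = let (e , e') = to (balanced-sem (suc B)) h in trans e (sym e')
  balancedUpTo-sound (suc B) (inj₂ h) = balancedUpTo-sound B h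

  balancedUpTo-complete : ∀ B → count NW? ≡ count SE? → count NW? ≤ B → σ , a ⊨₁ balancedUpTo B
  balancedUpTo-complete zero    e le = from (balanced-sem zero) (n≤0⇒n≡0 le , trans (sym e) (n≤0⇒n≡0 le))
  balancedUpTo-complete (suc B) e le with count NW? ≟ suc B
  ... | yes at-B = inj₁ (from (balanced-sem (suc B)) (at-B , trans (sym e) at-B))
  ... | no ¬at-B = inj₂ (balancedUpTo-complete B e (s≤s⁻¹ (≤∧≢⇒< le ¬at-B)))

-- Monotone subsequences

Increasing : ∀ {m N} → (Fin m → Fin N) → Set
Increasing f = ∀ i j → i F.< j → f i F.< f j

∷-increasing : ∀ {m N} {a : Fin N} {g : Fin m → Fin N} → (∀ j → a F.< g j) → Increasing g → Increasing (a ∷ g)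
∷-increasing below inc zero    (suc j) _  = below j
∷-increasing below inc (suc i) (suc j) lt = inc i j (s<s⁻¹ lt)

++-increasing : ∀ {m n N} {f : Fin m → Fin N} {g : Fin n → Fin N} →
                Increasing f → Increasing g → (∀ u v → f u F.< g v) → Increasing (f ++ g)
++-increasing {m} {n} {f = f} {g} inc-f inc-g cross i j lt with split-view m n i | split-view m n j
... | left u  | left u'  = subst₂ F._<_ (sym (lookup-++ˡ f g u)) (sym (lookup-++ˡ f g u')) (inc-f u u' (to (↑ˡ-<⇔ n) lt))
... | left u  | right v  = subst₂ F._<_ (sym (lookup-++ˡ f g u)) (sym (lookup-++ʳ f g v)) (cross u v)
... | right v | left u   = ⊥-elim (<-asym lt (↑ˡ<↑ʳ u v))
... | right v | right v' = subst₂ F._<_ (sym (lookup-++ʳ f g v)) (sym (lookup-++ʳ f g v')) (inc-g v v' (to (↑ʳ-<⇔ m) lt))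

+-≤-split : ∀ {A B a b} → A + B ≤ a + b → A ≤ a ⊎ B ≤ b
+-≤-split {A} {B} {a} {b} le with A ≤? a | B ≤? b
... | yes A≤a | _       = inj₁ A≤a
... | no _    | yes B≤b = inj₂ B≤b
... | no A≰a  | no B≰b  = ⊥-elim (<⇒≱ (+-mono-< (≰⇒> A≰a) (≰⇒> B≰b)) le)

erdősSzekeres : ℕ → ℕ → ℕ
erdősSzekeres zero    k       = 0
erdősSzekeres (suc m) zero    = 0
erdősSzekeres (suc m) (suc k) = suc (erdősSzekeres m (suc k) + erdősSzekeres (suc m) k)

module Monotone {N} (σ : Perm N) where

  _<σ_ _>σ_ : Fin N → Fin N → Set
  x <σ y = fun σ x F.< fun σ y
  x >σ y = fun σ y F.< fun σ x

  record MonotoneChain (_≺_ : Fin N → Fin N → Set) (m : ℕ) (Q : Fin N → Set) : Set where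
    constructor mkChain
    field
      elems    : Fin m → Fin N
      all-in   : ∀ i → Q (elems i)
      monotone : ∀ i j → i F.< j → elems i F.< elems j × elems i ≺ elems j

  module _ {_≺_ : Fin N → Fin N → Set} where

    MonotoneChain-[] : ∀ {Q} → MonotoneChain _≺_ 0 Q
    MonotoneChain-[] = mkChain [] (λ ()) λ ()

    MonotoneChain-map : ∀ {m Q Q'} → (∀ w → Q w → Q' w) → MonotoneChain _≺_ m Q → MonotoneChain _≺_ m Q'
    MonotoneChain-map f (mkChain e q o) = mkChain e (λ i → f (e i) (q i)) o

    MonotoneChain-∷ : ∀ {m Q} z → Q z → MonotoneChain _≺_ m (λ w → (z F.< w × Q w) × z ≺ w) →
                      MonotoneChain _≺_ (suc m) Q
    MonotoneChain-∷ {Q = Q} z qz (mkChain e q o) = mkChain (z ∷ e) all mono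
      where
      all : ∀ i → Q ((z ∷ e) i)
      all zero    = qz
      all (suc i) = proj₂ (proj₁ (q i))
      mono : ∀ i j → i F.< j → (z ∷ e) i F.< (z ∷ e) j × (z ∷ e) i ≺ (z ∷ e) j
      mono zero    (suc j) _  = proj₁ (proj₁ (q j)) , proj₂ (q j)
      mono (suc i) (suc j) lt = o i j (s<s⁻¹ lt)

  module _ {Q : Fin N → Set} (Q? : ∀ x → Dec (Q x)) (z : Fin N) where

    above? : ∀ w → Dec ((z F.< w × Q w) × z <σ w)
    above? w = after? Q? z w ×-dec (toℕ (fun σ z) <? toℕ (fun σ w))

    below? : ∀ w → Dec ((z F.< w × Q w) × z >σ w)
    below? w = after? Q? z w ×-dec (toℕ (fun σ w) <? toℕ (fun σ z))

    count-after : count (after? Q? z) ≡ count above? + count below?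
    count-after = count-⊎ (after? Q? z) above? below? split (λ w (_ , lt) (_ , gt) → <-asym lt gt)
      where
      split : ∀ w → (z F.< w × Q w) ⇔ ((z F.< w × Q w) × z <σ w ⊎ (z F.< w × Q w) × z >σ w)
      split w = mk⇔ (λ (z<w , qw) → case <-cmp (toℕ (fun σ z)) (toℕ (fun σ w)) of λ where
                       (tri< lt _ _) → inj₁ ((z<w , qw) , lt)
                       (tri≈ _ e _)  → ⊥-elim (<-irrefl (cong toℕ (inj σ (FP.toℕ-injective e))) z<w)
                       (tri> _ _ gt) → inj₂ ((z<w , qw) , gt))
                    [ proj₁ , proj₁ ]′

  increasing-or-decreasing : ∀ m k {Q} (Q? : ∀ x → Dec (Q x)) → erdősSzekeres m k ≤ count Q? →
                             MonotoneChain _<σ_ m Q ⊎ MonotoneChain _>σ_ k Q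
  increasing-or-decreasing zero    k       Q? _  = inj₁ MonotoneChain-[]
  increasing-or-decreasing (suc m) zero    Q? _  = inj₂ MonotoneChain-[]
  increasing-or-decreasing (suc m) (suc k) Q? le
    with ≤count⇒Chain (suc (erdősSzekeres m (suc k) + erdősSzekeres (suc m) k)) Q? le
  ... | z , qz , rest
    with +-≤-split (subst (_ ≤_) (count-after Q? z) (Chain⇒≤count _ (after? Q? z) rest))
  ... | inj₁ many-above = [ (λ inc → inj₁ (MonotoneChain-∷ z qz inc)) ,
                            (λ dec → inj₂ (MonotoneChain-map (λ _ → proj₂ ∘ proj₁) dec)) ]′
                          (increasing-or-decreasing m (suc k) (above? Q? z) many-above)
  ... | inj₂ many-below = [ (λ inc → inj₁ (MonotoneChain-map (λ _ → proj₂ ∘ proj₁) inc)) ,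
                            (λ dec → inj₂ (MonotoneChain-∷ z qz dec)) ]′
                          (increasing-or-decreasing (suc m) k (below? Q? z) many-below)

  decreasing⇒δ≼ : ∀ {k Q} → MonotoneChain _>σ_ k Q → δ k ≼ σ
  decreasing⇒δ≼ (mkChain e _ o) = e , (λ i j → proj₁ ∘ o i j) , λ i j →
    opposite-<⇔ i j ⟨⇔⟩ mk⇔ (proj₂ ∘ o j i) (reflect i j)
    where
    reflect : ∀ i j → e i <σ e j → j F.< i
    reflect i j lt with <-cmp (toℕ i) (toℕ j)
    ... | tri< i<j _ _ = ⊥-elim (<-asym lt (proj₂ (o i j i<j)))
    ... | tri≈ _ i≡j _ = ⊥-elim (<-irrefl (cong (λ x → toℕ (fun σ (e x))) (FP.toℕ-injective i≡j)) lt)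
    ... | tri> _ _ j<i = j<i

  module _ (a : Fin N) where
    open Quadrants σ a using (NW; SE)

    increasing⇒p321≼ : ∀ {m n} → MonotoneChain _<σ_ m NW → MonotoneChain _<σ_ n SE → p321 m n ≼ σ
    increasing⇒p321≼ {m} {n} (mkChain eN qN oN) (mkChain eS qS oS) =
      e , increasing , λ i j → p321-<⇔ m n i j ⟨⇔⟩ ⇔-sym (Shaped321-<⇔ m n shaped i j)
      where
      e : Fin (m + suc n) → Fin N
      e = eN ++ (a ∷ eS)
      increasing : Increasing e
      increasing = ++-increasing (λ i j → proj₁ ∘ oN i j)
                     (∷-increasing (proj₁ ∘ qS) (λ i j → proj₁ ∘ oS i j))
                     λ { u zero → proj₁ (qN u) ; u (suc v) → <-trans (proj₁ (qN u)) (proj₁ (qS v)) }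
      e-top : ∀ u → e (u ↑ˡ suc n) ≡ eN u
      e-top = lookup-++ˡ eN (a ∷ eS)
      e-right : ∀ j → e (m ↑ʳ j) ≡ (a ∷ eS) j
      e-right = lookup-++ʳ eN (a ∷ eS)
      <σ-subst : ∀ {x y x' y'} → x ≡ x' → y ≡ y' → x' <σ y' → x <σ y
      <σ-subst refl refl lt = lt
      shaped : Shaped321 m n (λ i → toℕ (fun σ (e i)))
      shaped = record
        { top-increasing    = λ u u' lt → <σ-subst (e-top u) (e-top u') (proj₂ (oN u u' lt))
        ; bottom-increasing = λ v v' lt → <σ-subst (e-right (suc v)) (e-right (suc v')) (proj₂ (oS v v' lt))
        ; middle<top        = λ u → <σ-subst (e-right zero) (e-top u) (proj₂ (qN u))
        ; bottom<middle     = λ v → <σ-subst (e-right (suc v)) (e-right zero) (proj₂ (qS v))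
        }

module _ {N} (σ : Perm N) (a : Fin N) where
  open Quadrants σ a
  open Monotone σ

  quadrant-bound : ∀ {k m n} → ¬ δ k ≼ σ → ¬ p321 m n ≼ σ → count NW? < erdősSzekeres m k ⊎ count SE? < erdősSzekeres n k
  quadrant-bound {k} {m} {n} ¬δ ¬p321 with erdősSzekeres m k ≤? count NW? | erdősSzekeres n k ≤? count SE?
  ... | no few | _      = inj₁ (≰⇒> few)
  ... | yes _  | no few = inj₂ (≰⇒> few)
  ... | yes many-NW | yes many-SE
    with increasing-or-decreasing m k NW? many-NW | increasing-or-decreasing n k SE? many-SE
  ... | inj₂ dec | _        = ⊥-elim (¬δ (decreasing⇒δ≼ dec))
  ... | inj₁ _   | inj₂ dec = ⊥-elim (¬δ (decreasing⇒δ≼ dec))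
  ... | inj₁ inc | inj₁ inc' = ⊥-elim (¬p321 (increasing⇒p321≼ a inc inc'))

avoids⇒formula : ∀ (C : PermClass) → IsPermClass C → Avoids321Patterns C → Σ (Formula 1) (FormulaDefinesFixedPoints C)
avoids⇒formula C closed (k , m , n , _ , _ , _ , ¬δ , ¬p321) = balancedUpTo B , defines
  where
  B : ℕ
  B = erdősSzekeres m k + erdősSzekeres n k

  defines : FormulaDefinesFixedPoints C (balancedUpTo B)
  defines σ Cσ a = mk⇔ (from fixed-point⇔ ∘ balancedUpTo-sound σ a B)
                       (λ fp → balancedUpTo-complete σ a B (to fixed-point⇔ fp) (small (to fixed-point⇔ fp)))
    where
    open Quadrants σ a
    small : count NW? ≡ count SE? → count NW? ≤ B
    small e with quadrant-bound σ a (¬δ ∘ closed _ σ Cσ) (¬p321 ∘ closed _ σ Cσ)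
    ... | inj₁ few-NW = ≤-trans (<⇒≤ few-NW) (m≤m+n _ _)
    ... | inj₂ few-SE = ≤-trans (<⇒≤ (subst (_< _) (sym e) few-SE)) (m≤n+m _ _)

formula⇒sentence : ∀ (C : PermClass) → Σ (Formula 1) (FormulaDefinesFixedPoints C) →
                   Σ Sentence (SentenceDefinesFixedPoints C)
formula⇒sentence C (φ , defines) = ∃′ φ , λ σ Cσ → mk⇔
  (λ (a , h) → a , to (defines σ Cσ a) (to (⊨-cong-≗ σ φ (only a)) h))
  (λ (a , e) → a , from (⊨-cong-≗ σ φ (only a)) (from (defines σ Cσ a) e))
  where
  only : ∀ {N} {ρ : Assignment 0 N} (a : Fin N) → (a ∷ₐ ρ) ≗ (λ _ → a)
  only a zero = refl

theorem5p3 : (C : ∀ {N} → Perm N → Set) → IsPermClass C →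
    ((Σ Sentence λ ψ → ∀ {N} (σ : Perm N) → C σ → (σ ⊨ₛ ψ) ⇔ HasFixedPoint σ)
      ⇔ (Σ (Formula 1) λ φ → ∀ {N} (σ : Perm N) → C σ → (a : _) → (σ , a ⊨₁ φ) ⇔ IsFixedPoint σ a))
    × ((Σ (Formula 1) λ φ → ∀ {N} (σ : Perm N) → C σ → (a : _) → (σ , a ⊨₁ φ) ⇔ IsFixedPoint σ a)
      ⇔ (Σ ℕ λ k → Σ ℕ λ m → Σ ℕ λ n → 0 < k × 0 < m × 0 < n × ¬ C (δ k) × ¬ C (p321 m n)))
theorem5p3 C closed =
  mk⇔ (avoids⇒formula C closed ∘ sentence⇒avoids′) (formula⇒sentence C) ,
  mk⇔ (sentence⇒avoids′ ∘ formula⇒sentence C) (avoids⇒formula C closed)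
  where
  sentence⇒avoids′ : Σ Sentence (SentenceDefinesFixedPoints C) → Avoids321Patterns C
  sentence⇒avoids′ (_ , defines) = sentence⇒avoids C closed defines
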